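{- Let $n>2$ be an integer (odd or even) and $q\in\mathcal{B}_n$. If there exists a (balanced) $q$-nearly bent function in $\mathcal{B}_n$, then $\rho_q\equiv 0\pmod 4$ when $wt(q)$ is even, and $\rho_q\equiv 2\pmod 4$ when $wt(q)$ is odd.
   Context: $V_n=\{0,1\}^n$ (row vectors) and $\mathcal{B}_n$ is the set of Boolean functions $V_n\to\{0,1\}$. $wt(f)=|\{a: f(a)=1\}|$; $f$ is balanced if $wt(f)=2^{n-1}$. $W(f,g)=\sum_{a\in V_n}(-1)^{f(a)+g(a)}$. $GL_n$ is the group of invertible $n\times n$ matrices over $\mathbb{F}_2$; $q_A(a)=q(aA)$; $W_q(f)(A)=W(f,q_A)$. $I_q=\sum_{a\in V_n}(-1)^{q(a)}$ and $\rho_q=\left\lceil\left(\frac{2^{2n}-I_q^2}{2^n-1}\right)^{1/2}\right\rceil$. A balanced $f\in\mathcal{B}_n$ is called $q$-nearly bent if $|W_q(f)(A)|\le\rho_q$ for all $A\in GL_n$. -}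

module Defs where

open import Data.Bool using (Bool; true; false; if_then_else_; _xor_; _∧_)
open import Data.Nat using (ℕ; zero; suc; _+_; _*_; _∸_; _^_; _≤_; _≤ᵇ_)
open import Data.Integer as ℤ using (ℤ; ∣_∣; -1ℤ; 1ℤ; 0ℤ)
open import Data.List using (List; []; _∷_; map; _++_; foldr)
open import Data.Vec using (Vec; []; _∷_; zipWith; replicate; tabulate)
open import Data.Fin using (Fin)
open import Data.Fin.Properties using () renaming (_≟_ to _≟ᶠ_)
open import Data.Product using (Σ; _×_)
open import Relation.Nullary.Decidable using (⌊_⌋)
open import Relation.Binary.PropositionalEquality using (_≡_)

-- V_n : row vectors of length n over F₂ (Bool with xor as addition, ∧ as multiplication)
V : ℕ → Set
V n = Vec Bool n

BF : ℕ → Set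
BF n = V n → Bool

allV : (n : ℕ) → List (V n)
allV zero = [] ∷ []
allV (suc n) = map (false ∷_) (allV n) ++ map (true ∷_) (allV n)

wt : {n : ℕ} → BF n → ℕ
wt {n} f = foldr (λ a s → (if f a then 1 else 0) + s) 0 (allV n)

balanced : {n : ℕ} → BF n → Set
balanced {n} f = wt f ≡ 2 ^ (n ∸ 1)

sgn : Bool → ℤ
sgn true = -1ℤ
sgn false = 1ℤ

W : {n : ℕ} → BF n → BF n → ℤ
W {n} f g = foldr (λ a s → sgn (f a xor g a) ℤ.+ s) 0ℤ (allV n)

I : {n : ℕ} → BF n → ℤ
I {n} q = foldr (λ a s → sgn (q a) ℤ.+ s) 0ℤ (allV n)

-- n × n matrices over F₂, given as a vector of rows
Mat : ℕ → Set
Mat n = Vec (Vec Bool n) n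

_⊕_ : {n : ℕ} → V n → V n → V n
_⊕_ = zipWith _xor_

scale : {n : ℕ} → Bool → V n → V n
scale b v = if b then v else replicate _ false

-- row vector times matrix: aA = Σ_i a_i · (row i of A)
mulVM : {m n : ℕ} → Vec Bool m → Vec (Vec Bool n) m → V n
mulVM [] [] = replicate _ false
mulVM (b ∷ a) (r ∷ A) = scale b r ⊕ mulVM a A

mulMM : {m n : ℕ} → Vec (Vec Bool n) m → Mat n → Vec (Vec Bool n) m
mulMM [] B = []
mulMM (r ∷ A) B = mulVM r B ∷ mulMM A B

idM : (n : ℕ) → Mat n
idM n = tabulate (λ i → tabulate (λ j → ⌊ i ≟ᶠ j ⌋))

InGL : {n : ℕ} → Mat n → Set
InGL {n} A = Σ (Mat n) (λ B → (mulMM A B ≡ idM n) × (mulMM B A ≡ idM n))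

qA : {n : ℕ} → BF n → Mat n → BF n
qA q A a = q (mulVM a A)

-- least r < b+1 with p r, or b if none in [0,b)  (bounded search)
least : ℕ → (ℕ → Bool) → ℕ
least zero p = zero
least (suc b) p = if p zero then zero else suc (least b (λ r → p (suc r)))

-- ⌈ (N / D)^{1/2} ⌉ for D ≥ 1: the least natural r with N ≤ r² · D
-- (r = N always qualifies when D ≥ 1, so searching r ∈ [0, N] suffices)
ceilSqrtFrac : ℕ → ℕ → ℕ
ceilSqrtFrac N D = least N (λ r → N ≤ᵇ r * r * D)

-- ρ_q = ⌈ ((2^{2n} − I_q²)/(2^n − 1))^{1/2} ⌉   (note I_q² = |I_q|² ≤ 2^{2n})
ρ : {n : ℕ} → BF n → ℕ
ρ {n} q = ceilSqrtFrac (2 ^ (2 * n) ∸ ∣ I q ∣ * ∣ I q ∣) (2 ^ n ∸ 1)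

NearlyBent : {n : ℕ} → BF n → BF n → Set
NearlyBent {n} q f = balanced f × ((A : Mat n) → InGL A → ∣ W f (qA q A) ∣ ≤ ρ q)

-- Average over GL_n.  GL_n acts transitively on nonzero vectors and on pairs of distinct nonzero
-- vectors (transvections suffice), so the correlation K(a,b) = Σ_{A ∈ GL_n} (-1)^{q(aA)+q(bA)} takes
-- only three values, which its row sums Σ_b K(a,b) = (Σ_A (-1)^{q(aA)}) I_q pin down.  Expanding the
-- square then gives, for balanced f, (2^n - 1) Σ_{A ∈ GL_n} W_q(f)(A)² = |GL_n| (2^{2n} - I_q²), so some
-- A has |W_q(f)(A)| ≥ ρ_q, with equality when f is q-nearly bent.  As f is balanced and q_A has the
-- weight of q, W_q(f)(A) = 4 wt(f q_A) - 2 wt(q), whose absolute value is 2 wt(q) modulo 4.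

module Submission where

open import Defs
open import Algebra.Bundles using (CommutativeRing)
import Algebra.Properties.CommutativeSemigroup as CommutativeSemigroupProperties
open import Data.Bool using (Bool; true; false; if_then_else_; _xor_; _∧_; T)
import Data.Bool.Properties as Bool
open import Data.Empty using (⊥-elim)
open import Data.Fin using (Fin; zero; suc)
import Data.Fin.Properties as Fin
open import Data.Integer as ℤ using (ℤ; +_; 0ℤ; 1ℤ; _+_; _*_; _-_)
import Data.Integer.Properties as ℤ
open import Data.Integer.Tactic.RingSolver using (solve-∀)
open import Data.List using (List; []; _∷_; map; _++_; foldr; length; cartesianProductWith)
import Data.List.Properties as List
open import Data.List.Membership.Propositional using (_∈_; lose)
open import Data.List.Relation.Unary.Any using (here; there; any?; satisfied)
open import Data.Nat as ℕ using (ℕ; zero; suc; _<_; _%_; z≤n; s≤s)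
import Data.Nat.Properties as ℕ
open import Data.Nat.DivMod using ([m+kn]%n≡m%n; m%n*o≡m*o%[n*o])
open import Data.Nat.Tactic.RingSolver using () renaming (solve-∀ to ℕ-solve-∀)
open import Data.Product using (Σ; _×_; _,_; proj₁; proj₂)
import Data.Product as Product
import Data.Sign.Properties as Sign
open import Data.Vec using (Vec; []; _∷_; zipWith; replicate; tabulate; lookup)
import Data.Vec as Vec
import Data.Vec.Properties as Vec
open import Data.Vec.Relation.Binary.Pointwise.Inductive using (Pointwise-≡⇒≡; zipWith-assoc; zipWith-comm; zipWith-identityˡ)
open import Relation.Binary.Definitions using (DecidableEquality)
open import Relation.Binary.PropositionalEquality
open import Relation.Nullary using (Dec; yes; no; does; contradiction)
open import Relation.Nullary.Decidable using (⌊_⌋; _×-dec_)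
open import Relation.Unary using (Decidable)

∑ : {X : Set} → List X → (X → ℤ) → ℤ
∑ L h = foldr (λ x s → h x + s) 0ℤ L

syntax ∑ L (λ x → e) = ∑[ x ∈ L ] e

module _ {X : Set} where

  ∑-cong : (L : List X) {g h : X → ℤ} → (∀ x → g x ≡ h x) → ∑ L g ≡ ∑ L h
  ∑-cong []      g≗h = refl
  ∑-cong (x ∷ L) g≗h = cong₂ _+_ (g≗h x) (∑-cong L g≗h)

  ∑-+ : (L : List X) (g h : X → ℤ) → ∑[ x ∈ L ] (g x + h x) ≡ ∑ L g + ∑ L h
  ∑-+ []      g h = refl
  ∑-+ (x ∷ L) g h rewrite ∑-+ L g h = CommutativeSemigroupProperties.interchange ℤ.+-commutativeSemigroup (g x) (h x) (∑ L g) (∑ L h)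

  ∑-*ˡ : (L : List X) (c : ℤ) (h : X → ℤ) → ∑[ x ∈ L ] (c * h x) ≡ c * ∑ L h
  ∑-*ˡ []      c h = sym (ℤ.*-zeroʳ c)
  ∑-*ˡ (x ∷ L) c h rewrite ∑-*ˡ L c h = sym (ℤ.*-distribˡ-+ c (h x) (∑ L h))

  ∑-*ʳ : (L : List X) (h : X → ℤ) (c : ℤ) → ∑[ x ∈ L ] (h x * c) ≡ ∑ L h * c
  ∑-*ʳ L h c = begin
    ∑[ x ∈ L ] (h x * c)  ≡⟨ ∑-cong L (λ x → ℤ.*-comm (h x) c) ⟩
    ∑[ x ∈ L ] (c * h x)  ≡⟨ ∑-*ˡ L c h ⟩
    c * ∑ L h             ≡⟨ ℤ.*-comm c (∑ L h) ⟩
    ∑ L h * c             ∎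
    where open ≡-Reasoning

  ∑-- : (L : List X) (g h : X → ℤ) → ∑[ x ∈ L ] (g x - h x) ≡ ∑ L g - ∑ L h
  ∑-- []      g h = refl
  ∑-- (x ∷ L) g h rewrite ∑-- L g h = regroup (g x) (h x) (∑ L g) (∑ L h)
    where
    regroup : ∀ a b c d → a - b + (c - d) ≡ a + c - (b + d)
    regroup = solve-∀

  ∑-zero : (L : List X) → ∑[ x ∈ L ] 0ℤ ≡ 0ℤ
  ∑-zero []      = refl
  ∑-zero (x ∷ L) = trans (ℤ.+-identityˡ _) (∑-zero L)

  ∑-const : (L : List X) (c : ℤ) → ∑[ x ∈ L ] c ≡ + length L * c
  ∑-const []      c = refl
  ∑-const (x ∷ L) c rewrite ∑-const L c = sym (ℤ.suc-* (+ length L) c)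

  ∑-++ : (L M : List X) (h : X → ℤ) → ∑ (L ++ M) h ≡ ∑ L h + ∑ M h
  ∑-++ []      M h = sym (ℤ.+-identityˡ _)
  ∑-++ (x ∷ L) M h rewrite ∑-++ L M h = sym (ℤ.+-assoc (h x) _ _)

∑-map : {X Y : Set} (f : X → Y) (L : List X) (h : Y → ℤ) → ∑ (map f L) h ≡ ∑[ x ∈ L ] h (f x)
∑-map f []      h = refl
∑-map f (x ∷ L) h = cong (λ s → h (f x) + s) (∑-map f L h)

∑-comm : {X Y : Set} (L : List X) (M : List Y) (h : X → Y → ℤ) →
  ∑[ x ∈ L ] ∑[ y ∈ M ] h x y ≡ ∑[ y ∈ M ] ∑[ x ∈ L ] h x y
∑-comm []      M h = sym (∑-zero M)
∑-comm (x ∷ L) M h rewrite ∑-comm L M h = sym (∑-+ M (h x) (λ y → ∑[ x ∈ L ] h x y))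

∑-cartesianProductWith : {X Y Z : Set} (f : X → Y → Z) (L : List X) (M : List Y) (h : Z → ℤ) →
  ∑ (cartesianProductWith f L M) h ≡ ∑[ x ∈ L ] ∑[ y ∈ M ] h (f x y)
∑-cartesianProductWith f []      M h = refl
∑-cartesianProductWith f (x ∷ L) M h = begin
  ∑ (map (f x) M ++ cartesianProductWith f L M) h
    ≡⟨ ∑-++ (map (f x) M) _ h ⟩
  ∑ (map (f x) M) h + ∑ (cartesianProductWith f L M) h
    ≡⟨ cong₂ _+_ (∑-map (f x) M h) (∑-cartesianProductWith f L M h) ⟩
  ∑[ y ∈ M ] h (f x y) + ∑[ x ∈ L ] ∑[ y ∈ M ] h (f x y) ∎
  where open ≡-Reasoning

∑-weighted-square : {X Y : Set} (L : List X) (M : List Y) (w : X → ℤ) (F : Y → ℤ) (g : X → Y → ℤ) →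
  ∑[ x ∈ L ] (w x * (∑[ a ∈ M ] (F a * g x a) * ∑[ b ∈ M ] (F b * g x b)))
    ≡ ∑[ a ∈ M ] ∑[ b ∈ M ] (F a * F b * ∑[ x ∈ L ] (w x * (g x a * g x b)))
∑-weighted-square {X} L M w F g = begin
  ∑[ x ∈ L ] (w x * (∑[ a ∈ M ] (F a * g x a) * inner x))
    ≡⟨ ∑-cong L (λ x → cong (w x *_) (sym (∑-*ʳ M (λ a → F a * g x a) (inner x)))) ⟩
  ∑[ x ∈ L ] (w x * ∑[ a ∈ M ] (F a * g x a * inner x))
    ≡⟨ ∑-cong L (λ x → sym (∑-*ˡ M (w x) _)) ⟩
  ∑[ x ∈ L ] ∑[ a ∈ M ] (w x * (F a * g x a * inner x))
    ≡⟨ ∑-cong L (λ x → ∑-cong M (λ a → cong (w x *_) (sym (∑-*ˡ M (F a * g x a) _)))) ⟩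
  ∑[ x ∈ L ] ∑[ a ∈ M ] (w x * ∑[ b ∈ M ] (F a * g x a * (F b * g x b)))
    ≡⟨ ∑-cong L (λ x → ∑-cong M (λ a → sym (∑-*ˡ M (w x) _))) ⟩
  ∑[ x ∈ L ] ∑[ a ∈ M ] ∑[ b ∈ M ] (w x * (F a * g x a * (F b * g x b)))
    ≡⟨ ∑-comm L M (λ x a → ∑[ b ∈ M ] (w x * (F a * g x a * (F b * g x b)))) ⟩
  ∑[ a ∈ M ] ∑[ x ∈ L ] ∑[ b ∈ M ] (w x * (F a * g x a * (F b * g x b)))
    ≡⟨ ∑-cong M (λ a → ∑-comm L M (λ x b → w x * (F a * g x a * (F b * g x b)))) ⟩
  ∑[ a ∈ M ] ∑[ b ∈ M ] ∑[ x ∈ L ] (w x * (F a * g x a * (F b * g x b)))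
    ≡⟨ ∑-cong M (λ a → ∑-cong M (λ b → ∑-cong L (λ x → rearrange (w x) (F a) (F b) (g x a) (g x b)))) ⟩
  ∑[ a ∈ M ] ∑[ b ∈ M ] ∑[ x ∈ L ] (F a * F b * (w x * (g x a * g x b)))
    ≡⟨ ∑-cong M (λ a → ∑-cong M (λ b → ∑-*ˡ L (F a * F b) _)) ⟩
  ∑[ a ∈ M ] ∑[ b ∈ M ] (F a * F b * ∑[ x ∈ L ] (w x * (g x a * g x b))) ∎
  where
  open ≡-Reasoning
  inner : X → ℤ
  inner x = ∑[ b ∈ M ] (F b * g x b)
  rearrange : ∀ i x y u v → i * (x * u * (y * v)) ≡ x * y * (i * (u * v))
  rearrange = solve-∀

ind : Bool → ℤ
ind b = if b then 1ℤ else 0ℤ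

ind-∧ : (a b : Bool) → ind (a ∧ b) ≡ ind a * ind b
ind-∧ true  b = sym (ℤ.*-identityˡ (ind b))
ind-∧ false b = refl

∑-nonpositive : {X : Set} (L : List X) (h : X → ℤ) → (∀ {x} → x ∈ L → h x ℤ.≤ 0ℤ) → ∑ L h ℤ.≤ 0ℤ
∑-nonpositive []      h nonpos = ℤ.≤-refl
∑-nonpositive (x ∷ L) h nonpos = ℤ.+-mono-≤ (nonpos (here refl)) (∑-nonpositive L h (λ x∈L → nonpos (there x∈L)))

∑-negative : {X : Set} (L : List X) (h : X → ℤ) → (∀ {x} → x ∈ L → h x ℤ.≤ 0ℤ) →
  {c : X} → c ∈ L → h c ℤ.< 0ℤ → ∑ L h ℤ.< 0ℤ
∑-negative (x ∷ L) h nonpos (here refl) hc<0 =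
  ℤ.+-mono-<-≤ hc<0 (∑-nonpositive L h (λ x∈L → nonpos (there x∈L)))
∑-negative (x ∷ L) h nonpos (there c∈L) hc<0 =
  ℤ.+-mono-≤-< (nonpos (here refl)) (∑-negative L h (λ x∈L → nonpos (there x∈L)) c∈L hc<0)

∃-nonnegative-term : {X : Set} {P : X → Set} (P? : Decidable P) (L : List X) (h : X → ℤ) →
  ∑[ x ∈ L ] (ind (does (P? x)) * h x) ≡ 0ℤ → {c : X} → c ∈ L → P c → Σ X (λ x → P x × 0ℤ ℤ.≤ h x)
∃-nonnegative-term {P = P} P? L h ∑≡0 {c} c∈L Pc with any? (λ x → P? x ×-dec (0ℤ ℤ.≤? h x)) L
... | yes found = satisfied found
... | no  none  = contradiction ∑≡0 (ℤ.<⇒≢ (∑-negative L _ term-nonpositive c∈L (term-negative c∈L Pc)))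
  where
  negative : ∀ {x} → x ∈ L → P x → h x ℤ.< 0ℤ
  negative x∈L Px = ℤ.≰⇒> (λ 0≤hx → none (lose x∈L (Px , 0≤hx)))
  term-negative : ∀ {x} → x ∈ L → P x → ind (does (P? x)) * h x ℤ.< 0ℤ
  term-negative {x} x∈L Px with P? x
  ... | yes _  = subst (ℤ._< 0ℤ) (sym (ℤ.*-identityˡ (h x))) (negative x∈L Px)
  ... | no ¬Px = contradiction Px ¬Px
  term-nonpositive : ∀ {x} → x ∈ L → ind (does (P? x)) * h x ℤ.≤ 0ℤ
  term-nonpositive {x} x∈L with P? x
  ... | yes Px = subst (ℤ._≤ 0ℤ) (sym (ℤ.*-identityˡ (h x))) (ℤ.<⇒≤ (negative x∈L Px))
  ... | no  _  = ℤ.≤-refl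

record Enumeration (X : Set) : Set where
  field
    _≟_      : DecidableEquality X
    elements : List X

  δ : X → X → ℤ
  δ c x = ind (does (c ≟ x))

  field
    occurs-once : ∀ c → ∑ elements (δ c) ≡ 1ℤ

module EnumerationProperties {X : Set} (E : Enumeration X) where
  open Enumeration E

  δ-* : (c x : X) (h : X → ℤ) → δ c x * h x ≡ δ c x * h c
  δ-* c x h with c ≟ x
  ... | yes refl = refl
  ... | no  _    = refl

  ∑-δ-* : (c : X) (h : X → ℤ) → ∑[ x ∈ elements ] (δ c x * h x) ≡ h c
  ∑-δ-* c h = begin
    ∑[ x ∈ elements ] (δ c x * h x)  ≡⟨ ∑-cong elements (λ x → trans (δ-* c x h) (ℤ.*-comm (δ c x) (h c))) ⟩
    ∑[ x ∈ elements ] (h c * δ c x)  ≡⟨ ∑-*ˡ elements (h c) (δ c) ⟩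
    h c * ∑ elements (δ c)           ≡⟨ cong (h c *_) (occurs-once c) ⟩
    h c * 1ℤ                         ≡⟨ ℤ.*-identityʳ (h c) ⟩
    h c                              ∎
    where open ≡-Reasoning

  ∑-bijection : (φ ψ : X → X) → (∀ x → ψ (φ x) ≡ x) → (∀ y → φ (ψ y) ≡ y) →
    (h : X → ℤ) → ∑[ x ∈ elements ] h (φ x) ≡ ∑ elements h
  ∑-bijection φ ψ ψφ φψ h = begin
    ∑[ x ∈ elements ] h (φ x)                                   ≡⟨ ∑-cong elements (λ x → sym (∑-δ-* (φ x) h)) ⟩
    ∑[ x ∈ elements ] ∑[ y ∈ elements ] (δ (φ x) y * h y)       ≡⟨ ∑-comm elements elements (λ x y → δ (φ x) y * h y) ⟩
    ∑[ y ∈ elements ] ∑[ x ∈ elements ] (δ (φ x) y * h y)       ≡⟨ ∑-cong elements (λ y → ∑-*ʳ elements (λ x → δ (φ x) y) (h y)) ⟩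
    ∑[ y ∈ elements ] (∑[ x ∈ elements ] δ (φ x) y * h y)       ≡⟨ ∑-cong elements (λ y → cong (_* h y) (trans (∑-cong elements (δ-transpose y)) (occurs-once (ψ y)))) ⟩
    ∑[ y ∈ elements ] (1ℤ * h y)                                ≡⟨ ∑-cong elements (λ y → ℤ.*-identityˡ (h y)) ⟩
    ∑ elements h                                                ∎
    where
    open ≡-Reasoning
    δ-transpose : ∀ y x → δ (φ x) y ≡ δ (ψ y) x
    δ-transpose y x with φ x ≟ y | ψ y ≟ x
    ... | yes _    | yes _     = refl
    ... | no  _    | no  _     = refl
    ... | yes refl | no ψφx≢x  = contradiction (ψφ x) ψφx≢x
    ... | no φx≢y  | yes refl  = contradiction (φψ y) φx≢y

  ∈-elements : (c : X) → c ∈ elements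
  ∈-elements c = search elements (occurs-once c)
    where
    search : (L : List X) → ∑ L (δ c) ≡ 1ℤ → c ∈ L
    search (x ∷ L) count with c ≟ x
    ... | yes c≡x = here c≡x
    ... | no  _   = there (search L (trans (sym (ℤ.+-identityˡ _)) count))

  ∃? : {P : X → Set} → Decidable P → Dec (Σ X P)
  ∃? P? with any? P? elements
  ... | yes p = yes (satisfied p)
  ... | no ¬p = no (λ (x , px) → ¬p (lose (∈-elements x) px))

  ∑-update : (c : X) (g h : X → ℤ) → (∀ x → x ≢ c → g x ≡ h x) → ∑ elements g ≡ ∑ elements h + (g c - h c)
  ∑-update c g h g≗h = begin
    ∑ elements g                                             ≡⟨ ∑-cong elements split ⟩
    ∑[ x ∈ elements ] (h x + δ c x * (g x - h x))            ≡⟨ ∑-+ elements h _ ⟩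
    ∑ elements h + ∑[ x ∈ elements ] (δ c x * (g x - h x))   ≡⟨ cong (λ s → ∑ elements h + s) (∑-δ-* c (λ x → g x - h x)) ⟩
    ∑ elements h + (g c - h c)                               ∎
    where
    open ≡-Reasoning
    difference-added : ∀ a b → b + 1ℤ * (a - b) ≡ a
    difference-added = solve-∀
    split : ∀ x → g x ≡ h x + δ c x * (g x - h x)
    split x with c ≟ x
    ... | yes refl = sym (difference-added (g x) (h x))
    ... | no  c≢x  = trans (g≗h x (λ x≡c → c≢x (sym x≡c))) (sym (ℤ.+-identityʳ (h x)))

  ∑-update₂ : (c d : X) → c ≢ d → (g h : X → ℤ) → (∀ x → x ≢ c → x ≢ d → g x ≡ h x) →
    ∑ elements g ≡ ∑ elements h + (g c - h c) + (g d - h d)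
  ∑-update₂ c d c≢d g h g≗h = begin
    ∑ elements g                              ≡⟨ ∑-update d g h′ g≗h′ ⟩
    ∑ elements h′ + (g d - h′ d)              ≡⟨ cong₂ (λ s t → s + (g d - t)) (∑-update c h′ h h′≗h) h′d≡hd ⟩
    ∑ elements h + (h′ c - h c) + (g d - h d)  ≡⟨ cong (λ t → ∑ elements h + (t - h c) + (g d - h d)) h′c≡gc ⟩
    ∑ elements h + (g c - h c) + (g d - h d)   ∎
    where
    open ≡-Reasoning
    h′ : X → ℤ
    h′ x = if does (c ≟ x) then g x else h x
    h′≗h : ∀ x → x ≢ c → h′ x ≡ h x
    h′≗h x x≢c with c ≟ x
    ... | yes c≡x = contradiction (sym c≡x) x≢c
    ... | no  _   = refl
    g≗h′ : ∀ x → x ≢ d → g x ≡ h′ x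
    g≗h′ x x≢d with c ≟ x
    ... | yes _   = refl
    ... | no  c≢x = g≗h x (λ x≡c → c≢x (sym x≡c)) x≢d
    h′d≡hd : h′ d ≡ h d
    h′d≡hd = h′≗h d (λ d≡c → c≢d (sym d≡c))
    h′c≡gc : h′ c ≡ g c
    h′c≡gc with c ≟ c
    ... | yes _   = refl
    ... | no  c≢c = contradiction refl c≢c

bools : List Bool
bools = false ∷ true ∷ []

Bool-enumeration : Enumeration Bool
Bool-enumeration = record { _≟_ = Bool._≟_ ; elements = bools ; occurs-once = λ { false → refl ; true → refl } }

vecs : {X : Set} → List X → (m : ℕ) → List (Vec X m)
vecs L zero    = [] ∷ []
vecs L (suc m) = cartesianProductWith _∷_ L (vecs L m)

Vec-enumeration : {X : Set} → Enumeration X → (m : ℕ) → Enumeration (Vec X m)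
Vec-enumeration {X} E m = record { _≟_ = Vec.≡-dec _≟_ ; elements = vecs elements m ; occurs-once = once }
  where
  open Enumeration E
  δᵥ : ∀ {m} → Vec X m → Vec X m → ℤ
  δᵥ c v = ind (does (Vec.≡-dec _≟_ c v))
  once : ∀ {m} (c : Vec X m) → ∑ (vecs elements m) (δᵥ c) ≡ 1ℤ
  once []       = refl
  once {suc m} (c ∷ cs) = begin
    ∑ (cartesianProductWith _∷_ elements (vecs elements m)) (δᵥ (c ∷ cs))
      ≡⟨ ∑-cartesianProductWith _∷_ elements (vecs elements m) (δᵥ (c ∷ cs)) ⟩
    ∑[ x ∈ elements ] ∑[ v ∈ vecs elements m ] δᵥ (c ∷ cs) (x ∷ v)
      ≡⟨ ∑-cong elements (λ x → ∑-cong (vecs elements m) (λ v → ind-∧ (does (c ≟ x)) _)) ⟩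
    ∑[ x ∈ elements ] ∑[ v ∈ vecs elements m ] (δ c x * δᵥ cs v)
      ≡⟨ ∑-cong elements (λ x → trans (∑-*ˡ (vecs elements m) (δ c x) (δᵥ cs)) (cong (δ c x *_) (once cs))) ⟩
    ∑[ x ∈ elements ] (δ c x * 1ℤ)
      ≡⟨ ∑-cong elements (λ x → ℤ.*-identityʳ (δ c x)) ⟩
    ∑ elements (δ c)
      ≡⟨ occurs-once c ⟩
    1ℤ ∎
    where open ≡-Reasoning

allV≡vecs : (n : ℕ) → allV n ≡ vecs bools n
allV≡vecs zero    = refl
allV≡vecs (suc n) rewrite allV≡vecs n =
  cong (map (false ∷_) (vecs bools n) ++_) (sym (List.++-identityʳ _))

V-enumeration : (n : ℕ) → Enumeration (V n)
V-enumeration n = record (Vec-enumeration Bool-enumeration n)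
  { elements = allV n
  ; occurs-once = λ c → subst (λ L → ∑ L (Enumeration.δ (Vec-enumeration Bool-enumeration n) c) ≡ 1ℤ)
                              (sym (allV≡vecs n)) (Enumeration.occurs-once (Vec-enumeration Bool-enumeration n) c) }

Mat-enumeration : (n : ℕ) → Enumeration (Mat n)
Mat-enumeration n = Vec-enumeration (V-enumeration n) n

allMat : (n : ℕ) → List (Mat n)
allMat n = Enumeration.elements (Mat-enumeration n)

length-allV : (n : ℕ) → length (allV n) ≡ 2 ℕ.^ n
length-allV zero    = refl
length-allV (suc n) = begin
  length (map (false ∷_) (allV n) ++ map (true ∷_) (allV n))  ≡⟨ List.length-++ (map (false ∷_) (allV n)) ⟩
  length (map (false ∷_) (allV n)) ℕ.+ length (map (true ∷_) (allV n))
    ≡⟨ cong₂ ℕ._+_ (List.length-map (false ∷_) (allV n)) (List.length-map (true ∷_) (allV n)) ⟩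
  length (allV n) ℕ.+ length (allV n)  ≡⟨ cong (λ k → k ℕ.+ k) (length-allV n) ⟩
  2 ℕ.^ n ℕ.+ 2 ℕ.^ n                  ≡⟨ cong (2 ℕ.^ n ℕ.+_) (sym (ℕ.+-identityʳ (2 ℕ.^ n))) ⟩
  2 ℕ.^ suc n ∎
  where open ≡-Reasoning

0v : {n : ℕ} → V n
0v = replicate _ false

xor-interchange : (a b c d : Bool) → (a xor b) xor (c xor d) ≡ (a xor c) xor (b xor d)
xor-interchange = CommutativeSemigroupProperties.interchange
  (CommutativeRing.+-commutativeSemigroup Bool.xor-∧-commutativeRing)

module _ {n : ℕ} where

  ⊕-assoc : (u v w : V n) → (u ⊕ v) ⊕ w ≡ u ⊕ (v ⊕ w)
  ⊕-assoc u v w = Pointwise-≡⇒≡ (zipWith-assoc Bool.xor-assoc u v w)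

  ⊕-comm : (u v : V n) → u ⊕ v ≡ v ⊕ u
  ⊕-comm u v = Pointwise-≡⇒≡ (zipWith-comm Bool.xor-comm u v)

  ⊕-identityˡ : (v : V n) → 0v ⊕ v ≡ v
  ⊕-identityˡ v = Pointwise-≡⇒≡ (zipWith-identityˡ Bool.xor-identityˡ v)

  ⊕-identityʳ : (v : V n) → v ⊕ 0v ≡ v
  ⊕-identityʳ v = trans (⊕-comm v 0v) (⊕-identityˡ v)

⊕-same : {n : ℕ} (v : V n) → v ⊕ v ≡ 0v
⊕-same []      = refl
⊕-same (a ∷ v) = cong₂ _∷_ (Bool.xor-same a) (⊕-same v)

⊕-interchange : {n : ℕ} (a b c d : V n) → (a ⊕ b) ⊕ (c ⊕ d) ≡ (a ⊕ c) ⊕ (b ⊕ d)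
⊕-interchange []      []      []      []      = refl
⊕-interchange (a ∷ u) (b ∷ v) (c ∷ w) (d ∷ x) = cong₂ _∷_ (xor-interchange a b c d) (⊕-interchange u v w x)

⊕-cancelˡ : {n : ℕ} (u v : V n) → u ⊕ (u ⊕ v) ≡ v
⊕-cancelˡ u v = trans (sym (⊕-assoc u u v)) (trans (cong (_⊕ v) (⊕-same u)) (⊕-identityˡ v))

scale-xor : {n : ℕ} (b c : Bool) (v : V n) → scale (b xor c) v ≡ scale b v ⊕ scale c v
scale-xor true  true  v = sym (⊕-same v)
scale-xor true  false v = sym (⊕-identityʳ v)
scale-xor false c     v = sym (⊕-identityˡ (scale c v))

scale-⊕ : {n : ℕ} (b : Bool) (u v : V n) → scale b (u ⊕ v) ≡ scale b u ⊕ scale b v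
scale-⊕ true  u v = refl
scale-⊕ false u v = sym (⊕-identityˡ 0v)

scale-∧ : {n : ℕ} (b c : Bool) (v : V n) → scale b (scale c v) ≡ scale (b ∧ c) v
scale-∧ true  c v = refl
scale-∧ false c v = refl

mulVM-0v : {m n : ℕ} (A : Vec (V n) m) → mulVM 0v A ≡ 0v
mulVM-0v []      = refl
mulVM-0v (r ∷ A) = trans (⊕-identityˡ _) (mulVM-0v A)

mulVM-⊕ : {m n : ℕ} (u v : Vec Bool m) (A : Vec (V n) m) → mulVM (u ⊕ v) A ≡ mulVM u A ⊕ mulVM v A
mulVM-⊕ []      []      []      = sym (⊕-identityˡ 0v)
mulVM-⊕ (a ∷ u) (b ∷ v) (r ∷ A) = begin
  scale (a xor b) r ⊕ mulVM (u ⊕ v) A                 ≡⟨ cong₂ _⊕_ (scale-xor a b r) (mulVM-⊕ u v A) ⟩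
  (scale a r ⊕ scale b r) ⊕ (mulVM u A ⊕ mulVM v A)   ≡⟨ ⊕-interchange _ _ _ _ ⟩
  (scale a r ⊕ mulVM u A) ⊕ (scale b r ⊕ mulVM v A)   ∎
  where open ≡-Reasoning

mulVM-scale : {m n : ℕ} (b : Bool) (u : Vec Bool m) (A : Vec (V n) m) → mulVM (scale b u) A ≡ scale b (mulVM u A)
mulVM-scale true  u A = refl
mulVM-scale false u A = mulVM-0v A

mulVM-mulMM : {m n : ℕ} (x : Vec Bool m) (A : Vec (V n) m) (B : Mat n) → mulVM x (mulMM A B) ≡ mulVM (mulVM x A) B
mulVM-mulMM []      []      B = sym (mulVM-0v B)
mulVM-mulMM (b ∷ x) (r ∷ A) B = begin
  scale b (mulVM r B) ⊕ mulVM x (mulMM A B)      ≡⟨ cong₂ _⊕_ (sym (mulVM-scale b r B)) (mulVM-mulMM x A B) ⟩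
  mulVM (scale b r) B ⊕ mulVM (mulVM x A) B      ≡⟨ sym (mulVM-⊕ (scale b r) (mulVM x A) B) ⟩
  mulVM (scale b r ⊕ mulVM x A) B                ∎
  where open ≡-Reasoning

mulMM-assoc : {m n : ℕ} (A : Vec (V n) m) (B C : Mat n) → mulMM (mulMM A B) C ≡ mulMM A (mulMM B C)
mulMM-assoc []      B C = refl
mulMM-assoc (r ∷ A) B C = cong₂ _∷_ (sym (mulVM-mulMM r B C)) (mulMM-assoc A B C)

mulMM≡map : {m n : ℕ} (A : Vec (V n) m) (B : Mat n) → mulMM A B ≡ Vec.map (λ r → mulVM r B) A
mulMM≡map []      B = refl
mulMM≡map (r ∷ A) B = cong (mulVM r B ∷_) (mulMM≡map A B)

unitV : {n : ℕ} → Fin n → V n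
unitV zero    = true ∷ 0v
unitV (suc i) = false ∷ unitV i

idM-suc : (n : ℕ) → idM (suc n) ≡ unitV zero ∷ Vec.map (false ∷_) (idM n)
idM-suc n = cong₂ _∷_ (cong (true ∷_) (tabulate-false n)) (begin
  tabulate (λ i → tabulate (λ j → ⌊ suc i Fin.≟ j ⌋))       ≡⟨ Vec.tabulate-cong (λ i → cong (false ∷_) (Vec.tabulate-cong (suc-≟ i))) ⟩
  tabulate (λ i → false ∷ tabulate (λ j → ⌊ i Fin.≟ j ⌋))    ≡⟨ Vec.tabulate-∘ (false ∷_) (λ i → tabulate (λ j → ⌊ i Fin.≟ j ⌋)) ⟩
  Vec.map (false ∷_) (idM n)                                 ∎)
  where
  open ≡-Reasoning
  tabulate-false : (n : ℕ) → tabulate {n = n} (λ _ → false) ≡ 0v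
  tabulate-false zero    = refl
  tabulate-false (suc n) = cong (false ∷_) (tabulate-false n)
  suc-≟ : (i j : Fin n) → ⌊ Fin.suc i Fin.≟ suc j ⌋ ≡ ⌊ i Fin.≟ j ⌋
  suc-≟ i j with i Fin.≟ j
  ... | yes _ = refl
  ... | no  _ = refl

mulVM-idM : {n : ℕ} (x : V n) → mulVM x (idM n) ≡ x
mulVM-idM {zero}  []      = refl
mulVM-idM {suc n} (b ∷ x) = begin
  mulVM (b ∷ x) (idM (suc n))                                 ≡⟨ cong (mulVM (b ∷ x)) (idM-suc n) ⟩
  scale b (unitV zero) ⊕ mulVM x (Vec.map (false ∷_) (idM n))  ≡⟨ cong (scale b (unitV zero) ⊕_) (mulVM-false∷ x (idM n)) ⟩
  scale b (unitV zero) ⊕ (false ∷ mulVM x (idM n))            ≡⟨ cong (λ v → scale b (unitV zero) ⊕ (false ∷ v)) (mulVM-idM x) ⟩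
  scale b (unitV zero) ⊕ (false ∷ x)                          ≡⟨ head-added b ⟩
  b ∷ x                                                       ∎
  where
  open ≡-Reasoning
  mulVM-false∷ : {m : ℕ} (y : Vec Bool m) (R : Vec (V n) m) → mulVM y (Vec.map (false ∷_) R) ≡ false ∷ mulVM y R
  mulVM-false∷ []          []      = refl
  mulVM-false∷ (true ∷ y)  (r ∷ R) = cong ((false ∷ r) ⊕_) (mulVM-false∷ y R)
  mulVM-false∷ (false ∷ y) (r ∷ R) = cong ((false ∷ 0v) ⊕_) (mulVM-false∷ y R)
  head-added : (b : Bool) → scale b (unitV zero) ⊕ (false ∷ x) ≡ b ∷ x
  head-added true  = cong (true ∷_) (⊕-identityˡ x)
  head-added false = cong (false ∷_) (⊕-identityˡ x)

map-mulVM-idM : {m n : ℕ} (A : Vec (V n) m) → Vec.map (λ r → mulVM r A) (idM m) ≡ A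
map-mulVM-idM {zero}  []      = refl
map-mulVM-idM {suc m} (r ∷ A) = trans (cong (Vec.map (λ x → mulVM x (r ∷ A))) (idM-suc m)) (
  cong₂ _∷_ (trans (cong (r ⊕_) (mulVM-0v A)) (⊕-identityʳ r)) (begin
    Vec.map (λ x → mulVM x (r ∷ A)) (Vec.map (false ∷_) (idM m))
      ≡⟨ sym (Vec.map-∘ (λ x → mulVM x (r ∷ A)) (false ∷_) (idM m)) ⟩
    Vec.map (λ x → 0v ⊕ mulVM x A) (idM m)   ≡⟨ Vec.map-cong (λ x → ⊕-identityˡ (mulVM x A)) (idM m) ⟩
    Vec.map (λ x → mulVM x A) (idM m)        ≡⟨ map-mulVM-idM A ⟩
    A                                        ∎))
  where open ≡-Reasoning

mulMM-identityˡ : {n : ℕ} (A : Mat n) → mulMM (idM n) A ≡ A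
mulMM-identityˡ {n} A = trans (mulMM≡map (idM n) A) (map-mulVM-idM A)

module _ {n : ℕ} where

  mulMM≡idM : {A B : Mat n} → (∀ x → mulVM (mulVM x A) B ≡ x) → mulMM A B ≡ idM n
  mulMM≡idM {A} {B} AB≗id = begin
    mulMM A B                                    ≡⟨ sym (mulMM-identityˡ (mulMM A B)) ⟩
    mulMM (idM n) (mulMM A B)                    ≡⟨ mulMM≡map (idM n) (mulMM A B) ⟩
    Vec.map (λ r → mulVM r (mulMM A B)) (idM n)  ≡⟨ Vec.map-cong (λ r → trans (mulVM-mulMM r A B) (AB≗id r)) (idM n) ⟩
    Vec.map (λ r → r) (idM n)                    ≡⟨ Vec.map-id (idM n) ⟩
    idM n                                        ∎
    where open ≡-Reasoning

  mulVM-cancel : {A B : Mat n} → mulMM A B ≡ idM n → ∀ x → mulVM (mulVM x A) B ≡ x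
  mulVM-cancel {A} {B} AB≡I x = trans (sym (mulVM-mulMM x A B)) (trans (cong (mulVM x) AB≡I) (mulVM-idM x))

  mulMM-cancel : {A B : Mat n} → mulMM A B ≡ idM n → ∀ C → mulMM A (mulMM B C) ≡ C
  mulMM-cancel {A} {B} AB≡I C = trans (sym (mulMM-assoc A B C))
    (trans (cong (λ P → mulMM P C) AB≡I) (mulMM-identityˡ C))

  InGL-inverse : {A : Mat n} (g : InGL A) → InGL (proj₁ g)
  InGL-inverse {A} (B , AB≡I , BA≡I) = A , BA≡I , AB≡I

  InGL-mulMM : {A B : Mat n} → InGL A → InGL B → InGL (mulMM A B)
  InGL-mulMM {A} {B} (A′ , AA′ , A′A) (B′ , BB′ , B′B) = mulMM B′ A′ , cancel A B B′ A′ BB′ AA′ , cancel B′ A′ A B A′A B′B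
    where
    cancel : ∀ P Q R S → mulMM Q R ≡ idM n → mulMM P S ≡ idM n → mulMM (mulMM P Q) (mulMM R S) ≡ idM n
    cancel P Q R S QR≡I PS≡I = trans (mulMM-assoc P Q (mulMM R S)) (trans (cong (mulMM P) (mulMM-cancel QR≡I S)) PS≡I)

  InGL-cancelˡ : {A C : Mat n} → InGL A → InGL (mulMM A C) → InGL C
  InGL-cancelˡ {A} {C} g gAC = subst InGL (mulMM-cancel (proj₂ (proj₂ g)) C) (InGL-mulMM (InGL-inverse g) gAC)

  InGL-idM : InGL (idM n)
  InGL-idM = idM n , mulMM-identityˡ (idM n) , mulMM-identityˡ (idM n)

  mulVM-injective : {A : Mat n} → InGL A → ∀ {x y} → mulVM x A ≡ mulVM y A → x ≡ y
  mulVM-injective {A} (B , AB≡I , _) {x} {y} xA≡yA =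
    trans (sym (mulVM-cancel AB≡I x)) (trans (cong (λ z → mulVM z B) xA≡yA) (mulVM-cancel AB≡I y))

dot : {n : ℕ} → V n → V n → Bool
dot []      []      = false
dot (a ∷ x) (b ∷ y) = (a ∧ b) xor dot x y

dot-comm : {n : ℕ} (x y : V n) → dot x y ≡ dot y x
dot-comm []      []      = refl
dot-comm (a ∷ x) (b ∷ y) = cong₂ _xor_ (Bool.∧-comm a b) (dot-comm x y)

dot-0vʳ : {n : ℕ} (x : V n) → dot x 0v ≡ false
dot-0vʳ []      = refl
dot-0vʳ (a ∷ x) rewrite Bool.∧-zeroʳ a = dot-0vʳ x

dot-⊕ˡ : {n : ℕ} (x y u : V n) → dot (x ⊕ y) u ≡ dot x u xor dot y u
dot-⊕ˡ []      []      []      = refl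
dot-⊕ˡ (a ∷ x) (b ∷ y) (c ∷ u) rewrite dot-⊕ˡ x y u | Bool.∧-distribʳ-xor c a b =
  xor-interchange (a ∧ c) (b ∧ c) (dot x u) (dot y u)

dot-⊕ʳ : {n : ℕ} (x u v : V n) → dot x (u ⊕ v) ≡ dot x u xor dot x v
dot-⊕ʳ x u v = trans (dot-comm x (u ⊕ v)) (trans (dot-⊕ˡ u v x) (cong₂ _xor_ (dot-comm u x) (dot-comm v x)))

dot-scaleˡ : {n : ℕ} (b : Bool) (x u : V n) → dot (scale b x) u ≡ b ∧ dot x u
dot-scaleˡ true  x u = refl
dot-scaleˡ false x u = trans (dot-comm 0v u) (dot-0vʳ u)

dot-unitV : {n : ℕ} (x : V n) (i : Fin n) → dot x (unitV i) ≡ lookup x i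
dot-unitV (a ∷ x) zero    rewrite dot-0vʳ x = trans (Bool.xor-identityʳ (a ∧ true)) (Bool.∧-identityʳ a)
dot-unitV (a ∷ x) (suc i) rewrite Bool.∧-zeroʳ a = dot-unitV x i

lookup-unitV-self : {n : ℕ} (i : Fin n) → lookup (unitV i) i ≡ true
lookup-unitV-self zero    = refl
lookup-unitV-self (suc i) = lookup-unitV-self i

lookup-unitV-other : {n : ℕ} {i k : Fin n} → i ≢ k → lookup (unitV i) k ≡ false
lookup-unitV-other {i = zero}  {zero}  i≢k = contradiction refl i≢k
lookup-unitV-other {i = zero}  {suc k} i≢k = Vec.lookup-replicate k false
lookup-unitV-other {i = suc i} {zero}  i≢k = refl
lookup-unitV-other {i = suc i} {suc k} i≢k = lookup-unitV-other (λ i≡k → i≢k (cong suc i≡k))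

transvection : {n : ℕ} → V n → V n → Mat n
transvection u w = zipWith (λ uᵢ r → r ⊕ scale uᵢ w) u (idM _)

mulVM-transvection : {n : ℕ} (u w x : V n) → mulVM x (transvection u w) ≡ x ⊕ scale (dot x u) w
mulVM-transvection u w x = trans (rows x u (idM _)) (cong (_⊕ scale (dot x u) w) (mulVM-idM x))
  where
  rows : {m : ℕ} (y v : Vec Bool m) (R : Vec (V _) m) →
    mulVM y (zipWith (λ vᵢ r → r ⊕ scale vᵢ w) v R) ≡ mulVM y R ⊕ scale (dot y v) w
  rows []      []      []      = sym (⊕-identityˡ 0v)
  rows (b ∷ y) (c ∷ v) (r ∷ R) = begin
    scale b (r ⊕ scale c w) ⊕ mulVM y (zipWith (λ vᵢ r → r ⊕ scale vᵢ w) v R)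
      ≡⟨ cong₂ _⊕_ (trans (scale-⊕ b r (scale c w)) (cong (scale b r ⊕_) (scale-∧ b c w))) (rows y v R) ⟩
    (scale b r ⊕ scale (b ∧ c) w) ⊕ (mulVM y R ⊕ scale (dot y v) w)
      ≡⟨ ⊕-interchange _ _ _ _ ⟩
    (scale b r ⊕ mulVM y R) ⊕ (scale (b ∧ c) w ⊕ scale (dot y v) w)
      ≡⟨ cong ((scale b r ⊕ mulVM y R) ⊕_) (sym (scale-xor (b ∧ c) (dot y v) w)) ⟩
    (scale b r ⊕ mulVM y R) ⊕ scale ((b ∧ c) xor dot y v) w ∎
    where open ≡-Reasoning

module _ {n : ℕ} where

  transvection-fixes : (u w x : V n) → dot x u ≡ false → mulVM x (transvection u w) ≡ x
  transvection-fixes u w x x⊥u rewrite mulVM-transvection u w x | x⊥u = ⊕-identityʳ x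

  transvection-involutive : (u w : V n) → dot w u ≡ false → ∀ x → mulVM (mulVM x (transvection u w)) (transvection u w) ≡ x
  transvection-involutive u w w⊥u x
    rewrite mulVM-transvection u w x | mulVM-transvection u w (x ⊕ scale (dot x u) w)
          | dot-⊕ˡ x (scale (dot x u) w) u | dot-scaleˡ (dot x u) w u | w⊥u
          | Bool.∧-zeroʳ (dot x u) | Bool.xor-identityʳ (dot x u)
          = trans (⊕-assoc x _ _) (trans (cong (x ⊕_) (⊕-same _)) (⊕-identityʳ x))

  InGL-transvection : (u w : V n) → dot w u ≡ false → InGL (transvection u w)
  InGL-transvection u w w⊥u = transvection u w , involution , involution
    where
    involution : mulMM (transvection u w) (transvection u w) ≡ idM n
    involution = mulMM≡idM (transvection-involutive u w w⊥u)

  transvection-carries : (u a b : V n) → dot a u ≡ true → dot b u ≡ true →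
    InGL (transvection u (a ⊕ b)) × mulVM a (transvection u (a ⊕ b)) ≡ b
  transvection-carries u a b a·u b·u = InGL-transvection u (a ⊕ b) ab⊥u , carries
    where
    ab⊥u : dot (a ⊕ b) u ≡ false
    ab⊥u rewrite dot-⊕ˡ a b u | a·u | b·u = refl
    carries : mulVM a (transvection u (a ⊕ b)) ≡ b
    carries rewrite mulVM-transvection u (a ⊕ b) a | a·u = ⊕-cancelˡ a b

  dot-unitV-⊕ : (x : V n) (k i : Fin n) → dot x (unitV k ⊕ unitV i) ≡ lookup x k xor lookup x i
  dot-unitV-⊕ x k i = trans (dot-⊕ʳ x (unitV k) (unitV i)) (cong₂ _xor_ (dot-unitV x k) (dot-unitV x i))

  -- With u = e_k if a_k = 1 and u = e_k + e_i otherwise, both a and e_k have inner product 1 with u.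
  to-unitV : (k i : Fin n) (a : V n) → lookup a i ≡ true →
    Σ (Mat n) (λ P → InGL P × mulVM a P ≡ unitV k × (∀ x → lookup x k ≡ false → lookup x i ≡ false → mulVM x P ≡ x))
  to-unitV k i a aᵢ with lookup a k in aₖ
  ... | true  = transvection u (a ⊕ unitV k) , proj₁ carried , proj₂ carried
              , λ x xₖ _ → transvection-fixes u _ x (trans (dot-unitV x k) xₖ)
    where
    u : V n
    u = unitV k
    a·u : dot a u ≡ true
    a·u = trans (dot-unitV a k) aₖ
    eₖ·u : dot (unitV k) u ≡ true
    eₖ·u = trans (dot-unitV (unitV k) k) (lookup-unitV-self k)
    carried : InGL (transvection u (a ⊕ unitV k)) × mulVM a (transvection u (a ⊕ unitV k)) ≡ unitV k
    carried = transvection-carries u a (unitV k) a·u eₖ·u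
  ... | false = transvection u (a ⊕ unitV k) , proj₁ carried , proj₂ carried
              , λ x xₖ xᵢ → transvection-fixes u _ x (trans (dot-unitV-⊕ x k i) (cong₂ _xor_ xₖ xᵢ))
    where
    u : V n
    u = unitV k ⊕ unitV i
    a·u : dot a u ≡ true
    a·u rewrite dot-unitV-⊕ a k i | aₖ | aᵢ = refl
    k≢i : k ≢ i
    k≢i refl = contradiction (trans (sym aₖ) aᵢ) λ ()
    eₖ·u : dot (unitV k) u ≡ true
    eₖ·u rewrite dot-unitV-⊕ (unitV k) k i | lookup-unitV-self k | lookup-unitV-other k≢i = refl
    carried : InGL (transvection u (a ⊕ unitV k)) × mulVM a (transvection u (a ⊕ unitV k)) ≡ unitV k
    carried = transvection-carries u a (unitV k) a·u eₖ·u

nonzero-coordinate : {n : ℕ} (a : V n) → a ≢ 0v → Σ (Fin n) (λ i → lookup a i ≡ true)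
nonzero-coordinate []          a≢0 = contradiction refl a≢0
nonzero-coordinate (true ∷ a)  a≢0 = zero , refl
nonzero-coordinate (false ∷ a) a≢0 with nonzero-coordinate a (λ a≡0 → a≢0 (cong (false ∷_) a≡0))
... | i , aᵢ = suc i , aᵢ

nonzero-tail-coordinate : {n : ℕ} (a : V (suc n)) → a ≢ 0v → a ≢ unitV zero → Σ (Fin n) (λ j → lookup a (suc j) ≡ true)
nonzero-tail-coordinate (false ∷ a) a≢0 a≢e₀ = nonzero-coordinate a (λ a≡0 → a≢0 (cong (false ∷_) a≡0))
nonzero-tail-coordinate (true ∷ a)  a≢0 a≢e₀ = nonzero-coordinate a (λ a≡0 → a≢e₀ (cong (true ∷_) a≡0))

GL-transitive : {m : ℕ} (a : V (suc m)) → a ≢ 0v → Σ (Mat (suc m)) (λ P → InGL P × mulVM a P ≡ unitV zero)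
GL-transitive a a≢0 =
  let (i , aᵢ) = nonzero-coordinate a a≢0
      (P , g , aP≡e₀ , _) = to-unitV zero i a aᵢ
  in P , g , aP≡e₀

stabiliser-of-e₀-transitive : {m : ℕ} (b : V (suc (suc m))) → b ≢ 0v → b ≢ unitV zero →
  Σ (Mat (suc (suc m))) (λ P → InGL P × mulVM (unitV zero) P ≡ unitV zero × mulVM b P ≡ unitV (suc zero))
stabiliser-of-e₀-transitive {m} b b≢0 b≢e₀ =
  let (j , b₁₊ⱼ) = nonzero-tail-coordinate b b≢0 b≢e₀
      (P , g , bP≡e₁ , P-fixes) = to-unitV (suc zero) (suc j) b b₁₊ⱼ
  in P , g , P-fixes (unitV zero) (Vec.lookup-replicate (zero {m}) false) (Vec.lookup-replicate j false) , bP≡e₁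

GL-2-transitive : {m : ℕ} (a b : V (suc (suc m))) → a ≢ 0v → b ≢ 0v → a ≢ b →
  Σ (Mat (suc (suc m))) (λ P → InGL P × mulVM a P ≡ unitV zero × mulVM b P ≡ unitV (suc zero))
GL-2-transitive a b a≢0 b≢0 a≢b =
  let (P₁ , g₁ , aP₁≡e₀) = GL-transitive a a≢0
      (P₂ , g₂ , e₀P₂≡e₀ , bP₁P₂≡e₁) = stabiliser-of-e₀-transitive (mulVM b P₁)
        (λ bP₁≡0 → b≢0 (mulVM-injective g₁ (trans bP₁≡0 (sym (mulVM-0v P₁)))))
        (λ bP₁≡e₀ → a≢b (mulVM-injective g₁ (trans aP₁≡e₀ (sym bP₁≡e₀))))
  in mulMM P₁ P₂ , InGL-mulMM g₁ g₂ ,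
     trans (mulVM-mulMM a P₁ P₂) (trans (cong (λ x → mulVM x P₂) aP₁≡e₀) e₀P₂≡e₀) ,
     trans (mulVM-mulMM b P₁ P₂) bP₁P₂≡e₁

module _ {n : ℕ} where
  open Enumeration (Mat-enumeration n) using (_≟_)

  InGL? : (A : Mat n) → Dec (InGL A)
  InGL? A = EnumerationProperties.∃? (Mat-enumeration n) (λ B → (mulMM A B ≟ idM n) ×-dec (mulMM B A ≟ idM n))

  ∑-mulMM : {P : Mat n} → InGL P → (h : Mat n → ℤ) → ∑[ A ∈ allMat n ] h (mulMM P A) ≡ ∑ (allMat n) h
  ∑-mulMM {P} (P′ , PP′ , P′P) = EnumerationProperties.∑-bijection (Mat-enumeration n)
    (mulMM P) (mulMM P′) (mulMM-cancel P′P) (mulMM-cancel PP′)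

  ∑-mulVM : {P : Mat n} → InGL P → (h : V n → ℤ) → ∑[ x ∈ allV n ] h (mulVM x P) ≡ ∑ (allV n) h
  ∑-mulVM {P} (P′ , PP′ , P′P) = EnumerationProperties.∑-bijection (V-enumeration n)
    (λ x → mulVM x P) (λ x → mulVM x P′) (mulVM-cancel PP′) (mulVM-cancel P′P)

  -- Kept opaque: unfolding the indicator would evaluate the search over all matrices.
  opaque
    χGL : Mat n → ℤ
    χGL A = ind (does (InGL? A))

    χGL≡ind : (A : Mat n) → χGL A ≡ ind (does (InGL? A))
    χGL≡ind A = refl

    χGL-mulMM : {P : Mat n} → InGL P → (A : Mat n) → χGL (mulMM P A) ≡ χGL A
    χGL-mulMM {P} g A with InGL? (mulMM P A) | InGL? A
    ... | yes _   | yes _   = refl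
    ... | no  _   | no  _   = refl
    ... | yes gPA | no  ¬gA = contradiction (InGL-cancelˡ g gPA) ¬gA
    ... | no ¬gPA | yes gA  = contradiction (InGL-mulMM g gA) ¬gPA

    χGL-*-∑-mulVM : (A : Mat n) (h : V n → ℤ) → χGL A * ∑[ x ∈ allV n ] h (mulVM x A) ≡ χGL A * ∑ (allV n) h
    χGL-*-∑-mulVM A h with InGL? A
    ... | yes g = cong (1ℤ *_) (∑-mulVM g h)
    ... | no  _ = refl

module ThreeValuedKernel {X : Set} (E : Enumeration X) (o : X) (K : X → X → ℤ) (G m k : ℤ)
  (K-diag : ∀ a → K a a ≡ G)
  (K-sym : ∀ a b → K a b ≡ K b a)
  (K-o : ∀ b → b ≢ o → K o b ≡ m)
  (K-off : ∀ a b → a ≢ o → b ≢ o → a ≢ b → K a b ≡ k) where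

  open Enumeration E using (elements)
  open EnumerationProperties E

  N : ℤ
  N = + length elements

  private
    K-off′ : ∀ a → a ≢ o → ∀ b → b ≢ o → b ≢ a → K a b ≡ k
    K-off′ a a≢o b b≢o b≢a = K-off a b a≢o b≢o (λ a≡b → b≢a (sym a≡b))

    o≢ : ∀ {a} → a ≢ o → o ≢ a
    o≢ a≢o o≡a = a≢o (sym o≡a)

  ∑-row-o : ∑ elements (K o) ≡ G + (N - 1ℤ) * m
  ∑-row-o = begin
    ∑ elements (K o)                       ≡⟨ ∑-update o (K o) (λ _ → m) K-o ⟩
    ∑[ b ∈ elements ] m + (K o o - m)      ≡⟨ cong₂ (λ s t → s + (t - m)) (∑-const elements m) (K-diag o) ⟩
    N * m + (G - m)                        ≡⟨ rearrange N G m ⟩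
    G + (N - 1ℤ) * m                       ∎
    where
    open ≡-Reasoning
    rearrange : ∀ N G m → N * m + (G - m) ≡ G + (N - 1ℤ) * m
    rearrange = solve-∀

  ∑-row : ∀ a → a ≢ o → ∑ elements (K a) ≡ G + m + (N - + 2) * k
  ∑-row a a≢o = begin
    ∑ elements (K a)                                  ≡⟨ ∑-update₂ o a (o≢ a≢o) (K a) (λ _ → k) (λ b b≢o b≢a → K-off′ a a≢o b b≢o b≢a) ⟩
    ∑[ b ∈ elements ] k + (K a o - k) + (K a a - k)   ≡⟨ cong₂ (λ s t → s + (t - k) + (K a a - k)) (∑-const elements k) (trans (K-sym a o) (K-o a a≢o)) ⟩
    N * k + (m - k) + (K a a - k)                     ≡⟨ cong (λ t → N * k + (m - k) + (t - k)) (K-diag a) ⟩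
    N * k + (m - k) + (G - k)                         ≡⟨ rearrange N G m k ⟩
    G + m + (N - + 2) * k                             ∎
    where
    open ≡-Reasoning
    rearrange : ∀ N G m k → N * k + (m - k) + (G - k) ≡ G + m + (N - + 2) * k
    rearrange = solve-∀

  module _ (F : X → ℤ) (F² : ∀ a → F a * F a ≡ 1ℤ) (∑F : ∑ elements F ≡ 0ℤ) where

    private
      ∑F* : (c : ℤ) → ∑[ b ∈ elements ] (F b * c) ≡ 0ℤ
      ∑F* c = trans (∑-*ʳ elements F c) (trans (cong (_* c) ∑F) (ℤ.*-zeroˡ c))

      weighted-row : X → ℤ
      weighted-row a = ∑[ b ∈ elements ] (F b * K a b)

      weighted-row-o : weighted-row o ≡ F o * (G - m)
      weighted-row-o = begin
        weighted-row o                                        ≡⟨ ∑-update o (λ b → F b * K o b) (λ b → F b * m) (λ b b≢o → cong (F b *_) (K-o b b≢o)) ⟩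
        ∑[ b ∈ elements ] (F b * m) + (F o * K o o - F o * m)  ≡⟨ cong₂ (λ s t → s + (F o * t - F o * m)) (∑F* m) (K-diag o) ⟩
        0ℤ + (F o * G - F o * m)                              ≡⟨ rearrange (F o) G m ⟩
        F o * (G - m)                                         ∎
        where
        open ≡-Reasoning
        rearrange : ∀ f G m → 0ℤ + (f * G - f * m) ≡ f * (G - m)
        rearrange = solve-∀

      weighted-row-off : ∀ a → a ≢ o → weighted-row a ≡ F o * (m - k) + F a * (G - k)
      weighted-row-off a a≢o = begin
        weighted-row a
          ≡⟨ ∑-update₂ o a (o≢ a≢o) (λ b → F b * K a b) (λ b → F b * k) (λ b b≢o b≢a → cong (F b *_) (K-off′ a a≢o b b≢o b≢a)) ⟩
        ∑[ b ∈ elements ] (F b * k) + (F o * K a o - F o * k) + (F a * K a a - F a * k)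
          ≡⟨ cong₂ (λ s t → s + (F o * t - F o * k) + (F a * K a a - F a * k)) (∑F* k) (trans (K-sym a o) (K-o a a≢o)) ⟩
        0ℤ + (F o * m - F o * k) + (F a * K a a - F a * k)
          ≡⟨ cong (λ t → 0ℤ + (F o * m - F o * k) + (F a * t - F a * k)) (K-diag a) ⟩
        0ℤ + (F o * m - F o * k) + (F a * G - F a * k)
          ≡⟨ rearrange (F o) (F a) G m k ⟩
        F o * (m - k) + F a * (G - k) ∎
        where
        open ≡-Reasoning
        rearrange : ∀ f g G m k → 0ℤ + (f * m - f * k) + (g * G - g * k) ≡ f * (m - k) + g * (G - k)
        rearrange = solve-∀

      term-off : ∀ a → a ≢ o → F a * weighted-row a ≡ F a * (F o * (m - k)) + (G - k)
      term-off a a≢o = begin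
        F a * weighted-row a                                  ≡⟨ cong (F a *_) (weighted-row-off a a≢o) ⟩
        F a * (F o * (m - k) + F a * (G - k))                 ≡⟨ rearrange (F a) (F o) (m - k) (G - k) ⟩
        F a * (F o * (m - k)) + F a * F a * (G - k)           ≡⟨ cong (λ s → F a * (F o * (m - k)) + s * (G - k)) (F² a) ⟩
        F a * (F o * (m - k)) + 1ℤ * (G - k)                  ≡⟨ cong (λ s → F a * (F o * (m - k)) + s) (ℤ.*-identityˡ (G - k)) ⟩
        F a * (F o * (m - k)) + (G - k)                       ∎
        where
        open ≡-Reasoning
        rearrange : ∀ f g x y → f * (g * x + f * y) ≡ f * (g * x) + f * f * y
        rearrange = solve-∀

    quadratic-form : ∑[ a ∈ elements ] ∑[ b ∈ elements ] (F a * F b * K a b) ≡ N * (G - k) - + 2 * (m - k)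
    quadratic-form = begin
      ∑[ a ∈ elements ] ∑[ b ∈ elements ] (F a * F b * K a b)
        ≡⟨ ∑-cong elements (λ a → trans (∑-cong elements (λ b → ℤ.*-assoc (F a) (F b) (K a b))) (∑-*ˡ elements (F a) (λ b → F b * K a b))) ⟩
      ∑[ a ∈ elements ] (F a * weighted-row a)
        ≡⟨ ∑-update o (λ a → F a * weighted-row a) (λ a → F a * (F o * (m - k)) + (G - k)) term-off ⟩
      ∑[ a ∈ elements ] (F a * (F o * (m - k)) + (G - k)) + (F o * weighted-row o - (F o * (F o * (m - k)) + (G - k)))
        ≡⟨ cong₂ (λ s t → s + (F o * t - (F o * (F o * (m - k)) + (G - k)))) (∑-+ elements (λ a → F a * (F o * (m - k))) (λ _ → G - k)) weighted-row-o ⟩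
      ∑[ a ∈ elements ] (F a * (F o * (m - k))) + ∑[ a ∈ elements ] (G - k) + (F o * (F o * (G - m)) - (F o * (F o * (m - k)) + (G - k)))
        ≡⟨ cong₂ (λ s t → s + t + (F o * (F o * (G - m)) - (F o * (F o * (m - k)) + (G - k)))) (∑F* (F o * (m - k))) (∑-const elements (G - k)) ⟩
      0ℤ + N * (G - k) + (F o * (F o * (G - m)) - (F o * (F o * (m - k)) + (G - k)))
        ≡⟨ collect (F o) N G m k (F² o) ⟩
      N * (G - k) - + 2 * (m - k) ∎
      where
      open ≡-Reasoning
      collect : ∀ f N G m k → f * f ≡ 1ℤ →
        0ℤ + N * (G - k) + (f * (f * (G - m)) - (f * (f * (m - k)) + (G - k))) ≡ N * (G - k) - + 2 * (m - k)
      collect f N G m k f²≡1 = begin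
        0ℤ + N * (G - k) + (f * (f * (G - m)) - (f * (f * (m - k)) + (G - k)))   ≡⟨ regroup f N G m k ⟩
        0ℤ + N * (G - k) + (f * f * (G - m) - (f * f * (m - k) + (G - k)))       ≡⟨ cong (λ s → 0ℤ + N * (G - k) + (s * (G - m) - (s * (m - k) + (G - k)))) f²≡1 ⟩
        0ℤ + N * (G - k) + (1ℤ * (G - m) - (1ℤ * (m - k) + (G - k)))            ≡⟨ simplify N G m k ⟩
        N * (G - k) - + 2 * (m - k)                                              ∎
        where
        regroup : ∀ f N G m k → 0ℤ + N * (G - k) + (f * (f * (G - m)) - (f * (f * (m - k)) + (G - k)))
                              ≡ 0ℤ + N * (G - k) + (f * f * (G - m) - (f * f * (m - k) + (G - k)))
        regroup = solve-∀
        simplify : ∀ N G m k → 0ℤ + N * (G - k) + (1ℤ * (G - m) - (1ℤ * (m - k) + (G - k))) ≡ N * (G - k) - + 2 * (m - k)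
        simplify = solve-∀

-- The three hypotheses are the row sums of the correlation kernel at 0 and at a nonzero vector,
-- and the factorisation of its value at (0, b); the left-hand side is (N - 1) times the quadratic form.
averaging-algebra : ∀ {N G I q₀ Y k} → q₀ * q₀ ≡ 1ℤ →
  G + (N - 1ℤ) * (q₀ * Y) ≡ q₀ * G * I → G + q₀ * Y + (N - + 2) * k ≡ Y * I →
  (N - 1ℤ) * (N * (G - k) - + 2 * (q₀ * Y - k)) ≡ G * (N * N - I * I)
averaging-algebra {N} {G} {I} {q₀} {Y} {k} q₀² row₀ row₁ = begin
  (N - 1ℤ) * (N * (G - k) - + 2 * (q₀ * Y - k))
    ≡⟨ expand N G I q₀ Y k ⟩
  G * (N * N - I * I)
    - (1ℤ + q₀ * I) * (G + (N - 1ℤ) * (q₀ * Y) - q₀ * G * I)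
    - (N - 1ℤ) * (G + q₀ * Y + (N - + 2) * k - Y * I)
    + ((N - 1ℤ) * Y * I - G * I * I) * (q₀ * q₀ - 1ℤ)
    ≡⟨ vanish (G * (N * N - I * I)) (1ℤ + q₀ * I) (N - 1ℤ) ((N - 1ℤ) * Y * I - G * I * I)
              (ℤ.i≡j⇒i-j≡0 row₀) (ℤ.i≡j⇒i-j≡0 row₁) (ℤ.i≡j⇒i-j≡0 q₀²) ⟩
  G * (N * N - I * I) ∎
  where
  open ≡-Reasoning
  expand : ∀ N G I q₀ Y k → (N - 1ℤ) * (N * (G - k) - + 2 * (q₀ * Y - k))
    ≡ G * (N * N - I * I)
      - (1ℤ + q₀ * I) * (G + (N - 1ℤ) * (q₀ * Y) - q₀ * G * I)
      - (N - 1ℤ) * (G + q₀ * Y + (N - + 2) * k - Y * I)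
      + ((N - 1ℤ) * Y * I - G * I * I) * (q₀ * q₀ - 1ℤ)
  expand = solve-∀
  vanish : ∀ X a b c {d₁ d₂ d₃} → d₁ ≡ 0ℤ → d₂ ≡ 0ℤ → d₃ ≡ 0ℤ → X - a * d₁ - b * d₂ + c * d₃ ≡ X
  vanish X a b c refl refl refl = simplify X a b c
    where
    simplify : ∀ X a b c → X - a * 0ℤ - b * 0ℤ + c * 0ℤ ≡ X
    simplify = solve-∀

sgn² : (b : Bool) → sgn b * sgn b ≡ 1ℤ
sgn² true  = refl
sgn² false = refl

sgn-xor : (a b : Bool) → sgn (a xor b) ≡ sgn a * sgn b
sgn-xor true  true  = refl
sgn-xor true  false = refl
sgn-xor false b     = sym (ℤ.*-identityˡ (sgn b))

sgn≡1-2ind : (b : Bool) → sgn b ≡ 1ℤ - + 2 * ind b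
sgn≡1-2ind true  = refl
sgn≡1-2ind false = refl

sgn-xor≡ind : (a b : Bool) → sgn (a xor b) ≡ 1ℤ - + 2 * ind a - + 2 * ind b + + 4 * ind (a ∧ b)
sgn-xor≡ind true  true  = refl
sgn-xor≡ind true  false = refl
sgn-xor≡ind false true  = refl
sgn-xor≡ind false false = refl

∑-ind≡wt : {n : ℕ} (f : BF n) → ∑[ a ∈ allV n ] ind (f a) ≡ + wt f
∑-ind≡wt {n} f = count (allV n)
  where
  count : (L : List (V n)) → ∑[ a ∈ L ] ind (f a) ≡ + foldr (λ a s → (if f a then 1 else 0) ℕ.+ s) 0 L
  count []      = refl
  count (a ∷ L) with f a
  ... | true  = trans (cong (λ s → 1ℤ + s) (count L)) (sym (ℤ.pos-+ 1 _))
  ... | false = trans (ℤ.+-identityˡ _) (count L)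

∑-allV-const : (n : ℕ) (c : ℤ) → ∑[ a ∈ allV n ] c ≡ + (2 ℕ.^ n) * c
∑-allV-const n c = trans (∑-const (allV n) c) (cong (λ l → + l * c) (length-allV n))

∑-scaled-ind : {n : ℕ} (c : ℤ) (h : BF n) → ∑[ a ∈ allV n ] (c * ind (h a)) ≡ c * + wt h
∑-scaled-ind {n} c h = trans (∑-*ˡ (allV n) c (λ a → ind (h a))) (cong (c *_) (∑-ind≡wt h))

∑-sgn : {n : ℕ} (f : BF n) → ∑[ a ∈ allV n ] sgn (f a) ≡ + (2 ℕ.^ n) - + 2 * + wt f
∑-sgn {n} f = begin
  ∑[ a ∈ allV n ] sgn (f a)                                ≡⟨ ∑-cong (allV n) (λ a → sgn≡1-2ind (f a)) ⟩
  ∑[ a ∈ allV n ] (1ℤ - + 2 * ind (f a))                   ≡⟨ ∑-- (allV n) (λ _ → 1ℤ) (λ a → + 2 * ind (f a)) ⟩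
  ∑[ a ∈ allV n ] 1ℤ - ∑[ a ∈ allV n ] (+ 2 * ind (f a))   ≡⟨ cong₂ _-_ (∑-allV-const n 1ℤ) (∑-scaled-ind (+ 2) f) ⟩
  + (2 ℕ.^ n) * 1ℤ - + 2 * + wt f                          ≡⟨ cong (_- + 2 * + wt f) (ℤ.*-identityʳ (+ (2 ℕ.^ n))) ⟩
  + (2 ℕ.^ n) - + 2 * + wt f                               ∎
  where open ≡-Reasoning

module Correlation {m : ℕ} (q : BF (suc (suc m))) where

  private
    n : ℕ
    n = suc (suc m)

  e₀ e₁ : V n
  e₀ = unitV zero
  e₁ = unitV (suc zero)

  Q : V n → ℤ
  Q a = sgn (q a)

  K : V n → V n → ℤ
  K a b = ∑[ A ∈ allMat n ] (χGL A * (Q (mulVM a A) * Q (mulVM b A)))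

  ordGL : ℤ
  ordGL = ∑ (allMat n) χGL

  K-invariant : {P : Mat n} → InGL P → ∀ a b {a′ b′} → mulVM a P ≡ a′ → mulVM b P ≡ b′ → K a b ≡ K a′ b′
  K-invariant {P} g a b refl refl = sym (trans (∑-cong (allMat n) moved) (∑-mulMM g (λ A → χGL A * (Q (mulVM a A) * Q (mulVM b A)))))
    where
    moved : ∀ A → χGL A * (Q (mulVM (mulVM a P) A) * Q (mulVM (mulVM b P) A))
                ≡ χGL (mulMM P A) * (Q (mulVM a (mulMM P A)) * Q (mulVM b (mulMM P A)))
    moved A = cong₂ _*_ (sym (χGL-mulMM g A))
                        (cong₂ (λ x y → Q x * Q y) (sym (mulVM-mulMM a P A)) (sym (mulVM-mulMM b P A)))

  K-diag : ∀ a → K a a ≡ ordGL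
  K-diag a = ∑-cong (allMat n) (λ A → trans (cong (χGL A *_) (sgn² (q (mulVM a A)))) (ℤ.*-identityʳ (χGL A)))

  K-sym : ∀ a b → K a b ≡ K b a
  K-sym a b = ∑-cong (allMat n) (λ A → cong (χGL A *_) (ℤ.*-comm (Q (mulVM a A)) (Q (mulVM b A))))

  K-0v : ∀ b → K 0v b ≡ Q 0v * ∑[ A ∈ allMat n ] (χGL A * Q (mulVM b A))
  K-0v b = trans (∑-cong (allMat n) factor) (∑-*ˡ (allMat n) (Q 0v) (λ A → χGL A * Q (mulVM b A)))
    where
    rearrange : ∀ χ x y → χ * (x * y) ≡ x * (χ * y)
    rearrange = solve-∀
    factor : ∀ A → χGL A * (Q (mulVM 0v A) * Q (mulVM b A)) ≡ Q 0v * (χGL A * Q (mulVM b A))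
    factor A = trans (cong (λ x → χGL A * (Q x * Q (mulVM b A))) (mulVM-0v A)) (rearrange (χGL A) (Q 0v) (Q (mulVM b A)))

  K-o : ∀ b → b ≢ 0v → K 0v b ≡ K 0v e₀
  K-o b b≢0 = let (P , g , bP≡e₀) = GL-transitive b b≢0 in K-invariant g 0v b (mulVM-0v P) bP≡e₀

  K-off : ∀ a b → a ≢ 0v → b ≢ 0v → a ≢ b → K a b ≡ K e₀ e₁
  K-off a b a≢0 b≢0 a≢b = let (P , g , aP≡e₀ , bP≡e₁) = GL-2-transitive a b a≢0 b≢0 a≢b in K-invariant g a b aP≡e₀ bP≡e₁

  ∑-K : ∀ a → ∑ (allV n) (K a) ≡ ∑[ A ∈ allMat n ] (χGL A * Q (mulVM a A)) * I q
  ∑-K a = begin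
    ∑[ b ∈ allV n ] ∑[ A ∈ allMat n ] (χGL A * (Q (mulVM a A) * Q (mulVM b A)))
      ≡⟨ ∑-comm (allV n) (allMat n) (λ b A → χGL A * (Q (mulVM a A) * Q (mulVM b A))) ⟩
    ∑[ A ∈ allMat n ] ∑[ b ∈ allV n ] (χGL A * (Q (mulVM a A) * Q (mulVM b A)))
      ≡⟨ ∑-cong (allMat n) row ⟩
    ∑[ A ∈ allMat n ] (χGL A * Q (mulVM a A) * I q)
      ≡⟨ ∑-*ʳ (allMat n) (λ A → χGL A * Q (mulVM a A)) (I q) ⟩
    ∑[ A ∈ allMat n ] (χGL A * Q (mulVM a A)) * I q ∎
    where
    open ≡-Reasoning
    rearrange₁ : ∀ χ x y → χ * (x * y) ≡ x * (χ * y)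
    rearrange₁ = solve-∀
    rearrange₂ : ∀ χ x y → x * (χ * y) ≡ χ * x * y
    rearrange₂ = solve-∀
    row : ∀ A → ∑[ b ∈ allV n ] (χGL A * (Q (mulVM a A) * Q (mulVM b A))) ≡ χGL A * Q (mulVM a A) * I q
    row A = begin
      ∑[ b ∈ allV n ] (χGL A * (Q (mulVM a A) * Q (mulVM b A)))  ≡⟨ ∑-cong (allV n) (λ b → rearrange₁ (χGL A) (Q (mulVM a A)) (Q (mulVM b A))) ⟩
      ∑[ b ∈ allV n ] (Q (mulVM a A) * (χGL A * Q (mulVM b A)))  ≡⟨ ∑-*ˡ (allV n) (Q (mulVM a A)) (λ b → χGL A * Q (mulVM b A)) ⟩
      Q (mulVM a A) * ∑[ b ∈ allV n ] (χGL A * Q (mulVM b A))    ≡⟨ cong (Q (mulVM a A) *_) (∑-*ˡ (allV n) (χGL A) (λ b → Q (mulVM b A))) ⟩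
      Q (mulVM a A) * (χGL A * ∑[ b ∈ allV n ] Q (mulVM b A))    ≡⟨ cong (Q (mulVM a A) *_) (χGL-*-∑-mulVM A Q) ⟩
      Q (mulVM a A) * (χGL A * I q)                              ≡⟨ rearrange₂ (χGL A) (Q (mulVM a A)) (I q) ⟩
      χGL A * Q (mulVM a A) * I q                                ∎

  open ThreeValuedKernel (V-enumeration n) 0v K ordGL (K 0v e₀) (K e₀ e₁) K-diag K-sym K-o K-off

  second-moment : (f : BF n) → ∑[ a ∈ allV n ] sgn (f a) ≡ 0ℤ →
    (N - 1ℤ) * ∑[ A ∈ allMat n ] (χGL A * (W f (qA q A) * W f (qA q A))) ≡ ordGL * (N * N - I q * I q)
  second-moment f ∑F≡0 = begin
    (N - 1ℤ) * ∑[ A ∈ allMat n ] (χGL A * (W f (qA q A) * W f (qA q A)))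
      ≡⟨ cong ((N - 1ℤ) *_) (trans (∑-cong (allMat n) (λ A → cong (λ w → χGL A * (w * w)) (W-as-product A)))
                                   (∑-weighted-square (allMat n) (allV n) χGL F (λ A a → Q (mulVM a A)))) ⟩
    (N - 1ℤ) * ∑[ a ∈ allV n ] ∑[ b ∈ allV n ] (F a * F b * K a b)
      ≡⟨ cong ((N - 1ℤ) *_) (quadratic-form F (λ a → sgn² (f a)) ∑F≡0) ⟩
    (N - 1ℤ) * (N * (ordGL - K e₀ e₁) - + 2 * (K 0v e₀ - K e₀ e₁))
      ≡⟨ cong (λ t → (N - 1ℤ) * (N * (ordGL - K e₀ e₁) - + 2 * (t - K e₀ e₁))) (K-0v e₀) ⟩
    (N - 1ℤ) * (N * (ordGL - K e₀ e₁) - + 2 * (Q 0v * Y - K e₀ e₁))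
      ≡⟨ averaging-algebra {N} {ordGL} {I q} {Q 0v} {Y} {K e₀ e₁} (sgn² (q 0v)) row₀ row₁ ⟩
    ordGL * (N * N - I q * I q) ∎
    where
    open ≡-Reasoning
    F : V n → ℤ
    F a = sgn (f a)
    Y : ℤ
    Y = ∑[ A ∈ allMat n ] (χGL A * Q (mulVM e₀ A))
    W-as-product : ∀ A → W f (qA q A) ≡ ∑[ a ∈ allV n ] (F a * Q (mulVM a A))
    W-as-product A = ∑-cong (allV n) (λ a → sgn-xor (f a) (q (mulVM a A)))
    weight-at-0v : ∑[ A ∈ allMat n ] (χGL A * Q (mulVM 0v A)) ≡ Q 0v * ordGL
    weight-at-0v = trans (∑-cong (allMat n) (λ A → trans (cong (λ x → χGL A * Q x) (mulVM-0v A)) (ℤ.*-comm (χGL A) (Q 0v))))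
                         (∑-*ˡ (allMat n) (Q 0v) χGL)
    row₀ : ordGL + (N - 1ℤ) * (Q 0v * Y) ≡ Q 0v * ordGL * I q
    row₀ = begin
      ordGL + (N - 1ℤ) * (Q 0v * Y)  ≡⟨ cong (λ t → ordGL + (N - 1ℤ) * t) (K-0v e₀) ⟨
      ordGL + (N - 1ℤ) * K 0v e₀     ≡⟨ ∑-row-o ⟨
      ∑ (allV n) (K 0v)              ≡⟨ ∑-K 0v ⟩
      ∑[ A ∈ allMat n ] (χGL A * Q (mulVM 0v A)) * I q  ≡⟨ cong (_* I q) weight-at-0v ⟩
      Q 0v * ordGL * I q             ∎
    row₁ : ordGL + Q 0v * Y + (N - + 2) * K e₀ e₁ ≡ Y * I q
    row₁ = begin
      ordGL + Q 0v * Y + (N - + 2) * K e₀ e₁  ≡⟨ cong (λ t → ordGL + t + (N - + 2) * K e₀ e₁) (K-0v e₀) ⟨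
      ordGL + K 0v e₀ + (N - + 2) * K e₀ e₁   ≡⟨ ∑-row e₀ (λ ()) ⟨
      ∑ (allV n) (K e₀)                       ≡⟨ ∑-K e₀ ⟩
      Y * I q                                 ∎

  N≡2ⁿ : N ≡ + (2 ℕ.^ n)
  N≡2ⁿ = cong +_ (length-allV n)

  ∃-large-W : (f : BF n) → ∑[ a ∈ allV n ] sgn (f a) ≡ 0ℤ →
    Σ (Mat n) (λ A → InGL A × + (2 ℕ.^ n) * + (2 ℕ.^ n) ℤ.≤ I q * I q + (+ (2 ℕ.^ n) - 1ℤ) * (W f (qA q A) * W f (qA q A)))
  ∃-large-W f ∑F≡0 = Product.map₂ (Product.map₂ bound)
    (∃-nonnegative-term InGL? (allMat n) excess
      (trans (∑-cong (allMat n) (λ A → cong (_* excess A) (sym (χGL≡ind A)))) ∑-excess)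
      (EnumerationProperties.∈-elements (Mat-enumeration n) (idM n)) InGL-idM)
    where
    W² : Mat n → ℤ
    W² A = W f (qA q A) * W f (qA q A)
    excess : Mat n → ℤ
    excess A = I q * I q + (N - 1ℤ) * W² A - N * N
    bound : ∀ {A} → 0ℤ ℤ.≤ excess A → + (2 ℕ.^ n) * + (2 ℕ.^ n) ℤ.≤ I q * I q + (+ (2 ℕ.^ n) - 1ℤ) * W² A
    bound {A} 0≤excess = subst (λ t → t * t ℤ.≤ I q * I q + (t - 1ℤ) * W² A) N≡2ⁿ (ℤ.0≤i-j⇒j≤i 0≤excess)
    ∑-excess : ∑[ A ∈ allMat n ] (χGL A * excess A) ≡ 0ℤ
    ∑-excess = begin
      ∑[ A ∈ allMat n ] (χGL A * excess A)
        ≡⟨ ∑-cong (allMat n) (λ A → distribute (χGL A) (I q * I q) (N - 1ℤ) (W² A) (N * N)) ⟩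
      ∑[ A ∈ allMat n ] (I q * I q * χGL A + (N - 1ℤ) * (χGL A * W² A) - N * N * χGL A)
        ≡⟨ ∑-- (allMat n) (λ A → I q * I q * χGL A + (N - 1ℤ) * (χGL A * W² A)) (λ A → N * N * χGL A) ⟩
      ∑[ A ∈ allMat n ] (I q * I q * χGL A + (N - 1ℤ) * (χGL A * W² A)) - ∑[ A ∈ allMat n ] (N * N * χGL A)
        ≡⟨ cong₂ _-_ (∑-+ (allMat n) (λ A → I q * I q * χGL A) (λ A → (N - 1ℤ) * (χGL A * W² A))) (∑-*ˡ (allMat n) (N * N) χGL) ⟩
      ∑[ A ∈ allMat n ] (I q * I q * χGL A) + ∑[ A ∈ allMat n ] ((N - 1ℤ) * (χGL A * W² A)) - N * N * ordGL
        ≡⟨ cong₂ (λ s t → s + t - N * N * ordGL) (∑-*ˡ (allMat n) (I q * I q) χGL)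
                 (trans (∑-*ˡ (allMat n) (N - 1ℤ) (λ A → χGL A * W² A)) (second-moment f ∑F≡0)) ⟩
      I q * I q * ordGL + ordGL * (N * N - I q * I q) - N * N * ordGL
        ≡⟨ cancel (I q * I q) (N * N) ordGL ⟩
      0ℤ ∎
      where
      open ≡-Reasoning
      distribute : ∀ χ i d w t → χ * (i + d * w - t) ≡ i * χ + d * (χ * w) - t * χ
      distribute = solve-∀
      cancel : ∀ i t G → i * G + G * (t - i) - t * G ≡ 0ℤ
      cancel = solve-∀

least-minimal : (b : ℕ) (p : ℕ → Bool) (r : ℕ) → T (p r) → least b p ℕ.≤ r
least-minimal zero    p r       pr = z≤n
least-minimal (suc b) p r       pr with p zero in p0
... | true  = z≤n
least-minimal (suc b) p zero    pr | false rewrite p0 = ⊥-elim pr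
least-minimal (suc b) p (suc r) pr | false = s≤s (least-minimal b (λ x → p (suc x)) r pr)

ceilSqrtFrac-minimal : ∀ N D r → N ℕ.≤ r ℕ.* r ℕ.* D → ceilSqrtFrac N D ℕ.≤ r
ceilSqrtFrac-minimal N D r N≤r²D = least-minimal N (λ r → N ℕ.≤ᵇ r ℕ.* r ℕ.* D) r (ℕ.≤⇒≤ᵇ N≤r²D)

square≡∣∣² : (i : ℤ) → i * i ≡ + (ℤ.∣ i ∣ ℕ.* ℤ.∣ i ∣)
square≡∣∣² i = trans (cong (ℤ._◃ (ℤ.∣ i ∣ ℕ.* ℤ.∣ i ∣)) (Sign.s*s≡+ (ℤ.sign i))) (ℤ.+◃n≡+n (ℤ.∣ i ∣ ℕ.* ℤ.∣ i ∣))

square-bound-ℕ : (t : ℕ) (i w : ℤ) → 1 ℕ.≤ t → + t * + t ℤ.≤ i * i + (+ t - 1ℤ) * (w * w) →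
  t ℕ.* t ℕ.≤ ℤ.∣ i ∣ ℕ.* ℤ.∣ i ∣ ℕ.+ ℤ.∣ w ∣ ℕ.* ℤ.∣ w ∣ ℕ.* (t ℕ.∸ 1)
square-bound-ℕ t i w 1≤t bound = ℤ.drop‿+≤+ (subst₂ ℤ._≤_ (sym (ℤ.pos-* t t)) rhs bound)
  where
  rhs : i * i + (+ t - 1ℤ) * (w * w) ≡ + (ℤ.∣ i ∣ ℕ.* ℤ.∣ i ∣ ℕ.+ ℤ.∣ w ∣ ℕ.* ℤ.∣ w ∣ ℕ.* (t ℕ.∸ 1))
  rhs = begin
    i * i + (+ t - 1ℤ) * (w * w)
      ≡⟨ cong₂ (λ a b → a + b * (w * w)) (square≡∣∣² i) (trans (ℤ.m-n≡m⊖n t 1) (ℤ.⊖-≥ 1≤t)) ⟩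
    + (ℤ.∣ i ∣ ℕ.* ℤ.∣ i ∣) + + (t ℕ.∸ 1) * (w * w)
      ≡⟨ cong (λ a → + (ℤ.∣ i ∣ ℕ.* ℤ.∣ i ∣) + + (t ℕ.∸ 1) * a) (square≡∣∣² w) ⟩
    + (ℤ.∣ i ∣ ℕ.* ℤ.∣ i ∣) + + (t ℕ.∸ 1) * + (ℤ.∣ w ∣ ℕ.* ℤ.∣ w ∣)
      ≡⟨ cong (λ a → + (ℤ.∣ i ∣ ℕ.* ℤ.∣ i ∣) + a) (sym (ℤ.pos-* (t ℕ.∸ 1) (ℤ.∣ w ∣ ℕ.* ℤ.∣ w ∣))) ⟩
    + (ℤ.∣ i ∣ ℕ.* ℤ.∣ i ∣) + + ((t ℕ.∸ 1) ℕ.* (ℤ.∣ w ∣ ℕ.* ℤ.∣ w ∣))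
      ≡⟨ sym (ℤ.pos-+ (ℤ.∣ i ∣ ℕ.* ℤ.∣ i ∣) ((t ℕ.∸ 1) ℕ.* (ℤ.∣ w ∣ ℕ.* ℤ.∣ w ∣))) ⟩
    + (ℤ.∣ i ∣ ℕ.* ℤ.∣ i ∣ ℕ.+ (t ℕ.∸ 1) ℕ.* (ℤ.∣ w ∣ ℕ.* ℤ.∣ w ∣))
      ≡⟨ cong (λ a → + (ℤ.∣ i ∣ ℕ.* ℤ.∣ i ∣ ℕ.+ a)) (ℕ.*-comm (t ℕ.∸ 1) (ℤ.∣ w ∣ ℕ.* ℤ.∣ w ∣)) ⟩
    + (ℤ.∣ i ∣ ℕ.* ℤ.∣ i ∣ ℕ.+ ℤ.∣ w ∣ ℕ.* ℤ.∣ w ∣ ℕ.* (t ℕ.∸ 1)) ∎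
    where open ≡-Reasoning

ρ-minimal : {n : ℕ} (q : BF n) (w : ℤ) →
  + (2 ℕ.^ n) * + (2 ℕ.^ n) ℤ.≤ I q * I q + (+ (2 ℕ.^ n) - 1ℤ) * (w * w) → ρ q ℕ.≤ ℤ.∣ w ∣
ρ-minimal {n} q w bound = ceilSqrtFrac-minimal (2 ℕ.^ (2 ℕ.* n) ℕ.∸ ∣I∣²) (2 ℕ.^ n ℕ.∸ 1) ℤ.∣ w ∣
  (ℕ.m≤n+o⇒m∸n≤o (2 ℕ.^ (2 ℕ.* n)) ∣I∣²
    (subst (ℕ._≤ ∣I∣² ℕ.+ ℤ.∣ w ∣ ℕ.* ℤ.∣ w ∣ ℕ.* (2 ℕ.^ n ℕ.∸ 1)) (sym 2^2n)
      (square-bound-ℕ (2 ℕ.^ n) (I q) w (ℕ.m^n>0 2 n) bound)))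
  where
  ∣I∣² : ℕ
  ∣I∣² = ℤ.∣ I q ∣ ℕ.* ℤ.∣ I q ∣
  2^2n : 2 ℕ.^ (2 ℕ.* n) ≡ 2 ℕ.^ n ℕ.* 2 ℕ.^ n
  2^2n = trans (cong (λ e → 2 ℕ.^ (n ℕ.+ e)) (ℕ.+-identityʳ n)) (ℕ.^-distribˡ-+-* 2 n n)

∑-sgn-balanced : {k : ℕ} (f : BF (suc k)) → balanced f → ∑[ a ∈ allV (suc k) ] sgn (f a) ≡ 0ℤ
∑-sgn-balanced {k} f wt≡ = begin
  ∑[ a ∈ allV (suc k) ] sgn (f a)          ≡⟨ ∑-sgn f ⟩
  + (2 ℕ.* 2 ℕ.^ k) - + 2 * + wt f          ≡⟨ cong₂ (λ s t → s - + 2 * + t) (ℤ.pos-* 2 (2 ℕ.^ k)) wt≡ ⟩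
  + 2 * + (2 ℕ.^ k) - + 2 * + (2 ℕ.^ k)      ≡⟨ ℤ.+-inverseʳ (+ 2 * + (2 ℕ.^ k)) ⟩
  0ℤ                                       ∎
  where open ≡-Reasoning

W≡wt : {n : ℕ} (f g : BF n) →
  W f g ≡ + (2 ℕ.^ n) - + 2 * + wt f - + 2 * + wt g + + 4 * + wt (λ a → f a ∧ g a)
W≡wt {n} f g = begin
  W f g
    ≡⟨ ∑-cong L (λ a → sgn-xor≡ind (f a) (g a)) ⟩
  ∑[ a ∈ L ] (1ℤ - + 2 * ind (f a) - + 2 * ind (g a) + + 4 * ind (f a ∧ g a))
    ≡⟨ ∑-+ L (λ a → 1ℤ - + 2 * ind (f a) - + 2 * ind (g a)) (λ a → + 4 * ind (f a ∧ g a)) ⟩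
  ∑[ a ∈ L ] (1ℤ - + 2 * ind (f a) - + 2 * ind (g a)) + ∑[ a ∈ L ] (+ 4 * ind (f a ∧ g a))
    ≡⟨ cong (_+ ∑[ a ∈ L ] (+ 4 * ind (f a ∧ g a))) (∑-- L (λ a → 1ℤ - + 2 * ind (f a)) (λ a → + 2 * ind (g a))) ⟩
  ∑[ a ∈ L ] (1ℤ - + 2 * ind (f a)) - ∑[ a ∈ L ] (+ 2 * ind (g a)) + ∑[ a ∈ L ] (+ 4 * ind (f a ∧ g a))
    ≡⟨ cong (λ s → s - ∑[ a ∈ L ] (+ 2 * ind (g a)) + ∑[ a ∈ L ] (+ 4 * ind (f a ∧ g a))) (∑-- L (λ _ → 1ℤ) (λ a → + 2 * ind (f a))) ⟩
  ∑[ a ∈ L ] 1ℤ - ∑[ a ∈ L ] (+ 2 * ind (f a)) - ∑[ a ∈ L ] (+ 2 * ind (g a)) + ∑[ a ∈ L ] (+ 4 * ind (f a ∧ g a))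
    ≡⟨ cong₂ (λ s t → s - t - ∑[ a ∈ L ] (+ 2 * ind (g a)) + ∑[ a ∈ L ] (+ 4 * ind (f a ∧ g a)))
             (trans (∑-allV-const n 1ℤ) (ℤ.*-identityʳ (+ (2 ℕ.^ n)))) (∑-scaled-ind (+ 2) f) ⟩
  + (2 ℕ.^ n) - + 2 * + wt f - ∑[ a ∈ L ] (+ 2 * ind (g a)) + ∑[ a ∈ L ] (+ 4 * ind (f a ∧ g a))
    ≡⟨ cong₂ (λ s t → + (2 ℕ.^ n) - + 2 * + wt f - s + t) (∑-scaled-ind (+ 2) g) (∑-scaled-ind (+ 4) (λ a → f a ∧ g a)) ⟩
  + (2 ℕ.^ n) - + 2 * + wt f - + 2 * + wt g + + 4 * + wt (λ a → f a ∧ g a) ∎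
  where
  open ≡-Reasoning
  L : List (V n)
  L = allV n

wt-qA : {n : ℕ} (q : BF n) {A : Mat n} → InGL A → + wt (qA q A) ≡ + wt q
wt-qA {n} q g = trans (sym (∑-ind≡wt (qA q _))) (trans (∑-mulVM g (λ a → ind (q a))) (∑-ind≡wt q))

W-balanced : {k : ℕ} (q f : BF (suc k)) → balanced f → {A : Mat (suc k)} → InGL A →
  W f (qA q A) ≡ (4 ℕ.* wt (λ a → f a ∧ q (mulVM a A))) ℤ.⊖ (2 ℕ.* wt q)
W-balanced {k} q f wt≡ {A} g = begin
  W f (qA q A)                                                     ≡⟨ W≡wt f (qA q A) ⟩
  + (2 ℕ.* 2 ℕ.^ k) - + 2 * + wt f - + 2 * + wt (qA q A) + + 4 * + x ≡⟨ cong₃ (ℤ.pos-* 2 (2 ℕ.^ k)) (cong +_ wt≡) (wt-qA q g) ⟩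
  + 2 * + (2 ℕ.^ k) - + 2 * + (2 ℕ.^ k) - + 2 * + wt q + + 4 * + x  ≡⟨ cancel (+ (2 ℕ.^ k)) (+ wt q) (+ x) ⟩
  + 4 * + x - + 2 * + wt q                                         ≡⟨ cong₂ _-_ (ℤ.pos-* 4 x) (ℤ.pos-* 2 (wt q)) ⟨
  + (4 ℕ.* x) - + (2 ℕ.* wt q)                                     ≡⟨ ℤ.m-n≡m⊖n (4 ℕ.* x) (2 ℕ.* wt q) ⟩
  (4 ℕ.* x) ℤ.⊖ (2 ℕ.* wt q)                                       ∎
  where
  open ≡-Reasoning
  x : ℕ
  x = wt (λ a → f a ∧ q (mulVM a A))
  cong₃ : ∀ {t t′ u u′ v v′} → t ≡ t′ → u ≡ u′ → v ≡ v′ → t - + 2 * u - + 2 * v + + 4 * + x ≡ t′ - + 2 * u′ - + 2 * v′ + + 4 * + x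
  cong₃ refl refl refl = refl
  cancel : ∀ t w x → + 2 * t - + 2 * t - + 2 * w + + 4 * x ≡ + 4 * x - + 2 * w
  cancel = solve-∀

∣4x⊖2w∣≡2w[mod4] : (x w : ℕ) → ℤ.∣ (4 ℕ.* x) ℤ.⊖ (2 ℕ.* w) ∣ % 4 ≡ (2 ℕ.* w) % 4
∣4x⊖2w∣≡2w[mod4] x w with 2 ℕ.* w ℕ.≤? 4 ℕ.* x
... | yes 2w≤4x rewrite ℤ.⊖-≥ 2w≤4x = begin
  (4 ℕ.* x ℕ.∸ 2 ℕ.* w) % 4                      ≡⟨ [m+kn]%n≡m%n (4 ℕ.* x ℕ.∸ 2 ℕ.* w) w 4 ⟨
  (4 ℕ.* x ℕ.∸ 2 ℕ.* w ℕ.+ w ℕ.* 4) % 4          ≡⟨ cong (_% 4) shift ⟩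
  (2 ℕ.* w ℕ.+ x ℕ.* 4) % 4                      ≡⟨ [m+kn]%n≡m%n (2 ℕ.* w) x 4 ⟩
  (2 ℕ.* w) % 4                                  ∎
  where
  open ≡-Reasoning
  shift : 4 ℕ.* x ℕ.∸ 2 ℕ.* w ℕ.+ w ℕ.* 4 ≡ 2 ℕ.* w ℕ.+ x ℕ.* 4
  shift = begin
    4 ℕ.* x ℕ.∸ 2 ℕ.* w ℕ.+ w ℕ.* 4                ≡⟨ regroup (4 ℕ.* x ℕ.∸ 2 ℕ.* w) w ⟩
    4 ℕ.* x ℕ.∸ 2 ℕ.* w ℕ.+ 2 ℕ.* w ℕ.+ 2 ℕ.* w    ≡⟨ cong (ℕ._+ 2 ℕ.* w) (ℕ.m∸n+n≡m 2w≤4x) ⟩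
    4 ℕ.* x ℕ.+ 2 ℕ.* w                            ≡⟨ swap x w ⟩
    2 ℕ.* w ℕ.+ x ℕ.* 4                            ∎
    where
    regroup : ∀ d w → d ℕ.+ w ℕ.* 4 ≡ d ℕ.+ 2 ℕ.* w ℕ.+ 2 ℕ.* w
    regroup = ℕ-solve-∀
    swap : ∀ x w → 4 ℕ.* x ℕ.+ 2 ℕ.* w ≡ 2 ℕ.* w ℕ.+ x ℕ.* 4
    swap = ℕ-solve-∀
... | no  2w≰4x rewrite ℤ.⊖-< (ℕ.≰⇒> 2w≰4x) | ℤ.∣-i∣≡∣i∣ (+ (2 ℕ.* w ℕ.∸ 4 ℕ.* x)) = begin
  (2 ℕ.* w ℕ.∸ 4 ℕ.* x) % 4                      ≡⟨ [m+kn]%n≡m%n (2 ℕ.* w ℕ.∸ 4 ℕ.* x) x 4 ⟨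
  (2 ℕ.* w ℕ.∸ 4 ℕ.* x ℕ.+ x ℕ.* 4) % 4          ≡⟨ cong (λ t → (2 ℕ.* w ℕ.∸ 4 ℕ.* x ℕ.+ t) % 4) (ℕ.*-comm x 4) ⟩
  (2 ℕ.* w ℕ.∸ 4 ℕ.* x ℕ.+ 4 ℕ.* x) % 4          ≡⟨ cong (_% 4) (ℕ.m∸n+n≡m (ℕ.<⇒≤ (ℕ.≰⇒> 2w≰4x))) ⟩
  (2 ℕ.* w) % 4                                  ∎
  where open ≡-Reasoning

∣4x⊖2w∣%4 : (x w : ℕ) → ℤ.∣ (4 ℕ.* x) ℤ.⊖ (2 ℕ.* w) ∣ % 4 ≡ (w % 2) ℕ.* 2
∣4x⊖2w∣%4 x w = trans (∣4x⊖2w∣≡2w[mod4] x w) (trans (cong (_% 4) (ℕ.*-comm 2 w)) (sym (m%n*o≡m*o%[n*o] w 2 2)))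

ρ≡∣W∣ : {m : ℕ} (q f : BF (suc (suc m))) → NearlyBent q f →
  Σ (Mat (suc (suc m))) (λ A → InGL A × ρ q ≡ ℤ.∣ W f (qA q A) ∣)
ρ≡∣W∣ q f (balanced-f , W-bounded) =
  let (A , g , bound) = Correlation.∃-large-W q f (∑-sgn-balanced f balanced-f)
  in A , g , ℕ.≤-antisym (ρ-minimal q (W f (qA q A)) bound) (W-bounded A g)

ρ%4 : {m : ℕ} (q f : BF (suc (suc m))) → NearlyBent q f → ρ q % 4 ≡ (wt q % 2) ℕ.* 2
ρ%4 q f nearly-bent@(balanced-f , _) =
  let (A , g , ρ≡∣Wₐ∣) = ρ≡∣W∣ q f nearly-bent
  in trans (cong (_% 4) (trans ρ≡∣Wₐ∣ (cong ℤ.∣_∣ (W-balanced q f balanced-f g)))) (∣4x⊖2w∣%4 (wt (λ a → f a ∧ q (mulVM a A))) (wt q))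

-- The argument only needs n ≥ 2.
theorem3 : (n : ℕ) → 2 < n → (q : BF n) → Σ (BF n) (λ f → NearlyBent q f) →
    ((wt q % 2 ≡ 0 → ρ q % 4 ≡ 0) × (wt q % 2 ≡ 1 → ρ q % 4 ≡ 2))
theorem3 (suc (suc (suc k))) (s≤s (s≤s (s≤s z≤n))) q (f , nearly-bent) =
  (λ even → trans (ρ%4 q f nearly-bent) (cong (ℕ._* 2) even)) ,
  (λ odd  → trans (ρ%4 q f nearly-bent) (cong (ℕ._* 2) odd))
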